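{- For trees $t,z\in\mathcal T_n$, one has $t\le_B z$ in $\mathcal T_n$ if and only if there exist $\gamma\in\Gamma^{ -1}(t)$ and $\delta\in\Gamma^{ -1}(z)$ with $\gamma\le_B\delta$ in $\mathcal P_n$; that is, the weak Bruhat order of $\mathcal P_\infty$ induces, via $\Gamma$, the order $\le_B$ on $\mathcal T_\infty$.
   Context: $\mathcal P_n$ ($n\ge1$): surjective maps $\gamma:\{1,\dots,n\}\to\{1,\dots,r\}$, $r\ge1$; $\mathcal P_{n,r}$ those with image $\{1,\dots,r\}$; $\mathcal P_0=\{(0)\}$. Weak Bruhat order on $\mathcal P_n$: reflexive transitive closure of $\gamma<_B t_i\circ\gamma$ if every element of $\gamma^{ -1}(i)$ is less than every element of $\gamma^{ -1}(i+1)$, and $t_i\circ\gamma<_B\gamma$ if every element of $\gamma^{ -1}(i)$ exceeds every element of $\gamma^{ -1}(i+1)$, where for $\gamma\in\mathcal P_{n,r}$ and $1\le i\le r-1$, $t_i(j)=j$ ($j\le i$), $j-1$ ($j>i$). Trees: planar rooted trees with each vertex having $\ge2$ ordered incoming edges and one outgoing edge; $\mathcal T_n$ those with $n+1$ leaves, $\mathcal T_0=\{\downarrow\}$; $\bigvee(t^0,\dots,t^k)$ ($k\ge1$) joins the roots of $t^0,\dots,t^k$ in order to a new vertex with a new root. $\le_B$ on trees is the smallest family of reflexive transitive relations with: (1) $t^{i_0}<_B w^{i_0}$ in $\mathcal T_{n_{i_0}}$ implies $\bigvee(t^0,\dots,t^{i_0},\dots,t^k)<_B\bigvee(t^0,\dots,w^{i_0},\dots,t^k)$;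 (2) $\bigvee(t,w^0,\dots,w^h)<_B\bigvee(t^0,\dots,t^k,w^0,\dots,w^h)$ if $t=\bigvee(t^0,\dots,t^k)$; (3) $t<_B\bigvee(t^0,\dots,t^j,\bigvee(t^{j+1},\dots,t^k))$ if $t=\bigvee(t^0,\dots,t^k)$ and $0\le j\le k-2$. $\Gamma$: $\Gamma((0))=\downarrow$; for $\gamma\in\mathcal P_{n,r}$ with $\gamma^{ -1}(r)=\{j_1<\dots<j_k\}$, $j_0=0$, $j_{k+1}=n+1$, let $\gamma_i$ be $\gamma$ restricted to $\{j_i+1,\dots,j_{i+1}-1\}$ (reindexed from 1) with image relabeled order-preservingly onto $\{1,\dots,r_i\}$ ($(0)$ if empty); $\Gamma(\gamma)=\bigvee(\Gamma(\gamma_0),\dots,\Gamma(\gamma_k))$. -}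

module Defs where

open import Data.Nat using (ℕ; zero; suc; _+_; _∸_; _≤_; _<_; _⊔_; _≤ᵇ_; _≡ᵇ_)
open import Data.Nat.Properties using (_≟_)
open import Data.Bool using (if_then_else_)
open import Data.List using (List; []; _∷_; _++_; [_]; length; map; foldr; filter; upTo; lookup)
open import Data.List.Relation.Unary.All using (All)
open import Data.List.Membership.Propositional using (_∈_)
open import Data.List.Membership.DecPropositional _≟_ using (_∈?_)
open import Data.Fin using (Fin; toℕ)
open import Data.Product using (Σ; _×_; ∃; _,_)
open import Relation.Binary.PropositionalEquality using (_≡_)
open import Relation.Binary.Construct.Closure.ReflexiveTransitive using (Star)

-- Surjective maps γ : {1..n} → {1..r} as words (γ(1), …, γ(n)).
-- The empty word [] represents the unique element (0) of P₀.

maxW : List ℕ → ℕ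
maxW = foldr _⊔_ 0

Packed : List ℕ → Set
Packed γ = All (λ x → 1 ≤ x) γ × (∀ j → 1 ≤ j → j ≤ maxW γ → j ∈ γ)

InP : ℕ → List ℕ → Set
InP n γ = length γ ≡ n × Packed γ

merge : ℕ → List ℕ → List ℕ
merge i = map (λ j → if j ≤ᵇ i then j else j ∸ 1)

Before : List ℕ → ℕ → ℕ → Set
Before γ a b = (p q : Fin (length γ)) → lookup γ p ≡ a → lookup γ q ≡ b → toℕ p < toℕ q

data BStep : List ℕ → List ℕ → Set where
  up   : ∀ {γ} i → Packed γ → 1 ≤ i → i < maxW γ →
         Before γ i (suc i) → BStep γ (merge i γ)
  down : ∀ {γ} i → Packed γ → 1 ≤ i → i < maxW γ →
         Before γ (suc i) i → BStep (merge i γ) γ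

_≤P_ : List ℕ → List ℕ → Set
_≤P_ = Star BStep

data Tree : Set where
  leaf : Tree
  node : List Tree → Tree

data Valid : Tree → Set where
  leaf : Valid leaf
  node : ∀ {ts} → 2 ≤ length ts → All Valid ts → Valid (node ts)

mutual
  leaves : Tree → ℕ
  leaves leaf = 1
  leaves (node ts) = leavesL ts

  leavesL : List Tree → ℕ
  leavesL [] = 0
  leavesL (t ∷ ts) = leaves t + leavesL ts

InT : ℕ → Tree → Set
InT n t = Valid t × leaves t ≡ suc n

data _≤T_ : Tree → Tree → Set where
  refl  : ∀ {t} → t ≤T t
  trans : ∀ {t u v} → t ≤T u → u ≤T v → t ≤T v
  rule1 : ∀ {ls rs t w} → 1 ≤ length ls + length rs →
          All Valid ls → All Valid rs → Valid t → Valid w →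
          t ≤T w → node (ls ++ t ∷ rs) ≤T node (ls ++ w ∷ rs)
  rule2 : ∀ {ts ws} → 2 ≤ length ts → 1 ≤ length ws →
          All Valid ts → All Valid ws →
          node (node ts ∷ ws) ≤T node (ts ++ ws)
  rule3 : ∀ {ts us} → 1 ≤ length ts → 2 ≤ length us →
          All Valid ts → All Valid us →
          node (ts ++ us) ≤T node (ts ++ [ node us ])

rank : List ℕ → ℕ → ℕ
rank w x = length (filter (λ v → v ∈? w) (map suc (upTo x)))

std : List ℕ → List ℕ
std w = map (rank w) w

splitAtVal : ℕ → List ℕ → List (List ℕ)
splitAtVal r [] = [] ∷ []
splitAtVal r (x ∷ xs) with splitAtVal r xs
... | [] = [] -- impossible
... | s ∷ ss = if x ≡ᵇ r then [] ∷ s ∷ ss else (x ∷ s) ∷ ss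

-- fuel-bounded recursion (fuel = length + 1 always suffices)
Γf : ℕ → List ℕ → Tree
Γf zero γ = leaf
Γf (suc f) [] = leaf
Γf (suc f) (x ∷ xs) =
  node (map (λ s → Γf f (std s)) (splitAtVal (maxW (x ∷ xs)) (x ∷ xs)))

Γ : List ℕ → Tree
Γ γ = Γf (suc (length γ)) γ

-- Γ is monotone: let a Bruhat step merge i and i + 1. If i + 1 is the
-- maximum r of the word, cutting the word at the first (last) occurrence of
-- i + 1 shows that the step is one instance of rule (2) (rule (3)).
-- Otherwise the step happens inside the blocks between the occurrences of r,
-- and is handled by induction on the length together with rule (1).
--
-- Conversely, numbering the internal vertices of a tree in postorder and
-- writing the number of each vertex between the words of its subtrees gives
-- a section of Γ with values in P_n, and each tree rule becomes a Bruhat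
-- chain between sections: rule (3) is a single down step, rule (1) a chain
-- inside the word of a context, and rule (2) rotates the root of the first
-- subtree through the values of the other subtrees by transpositions and
-- then merges it with the root in one up step.
module Submission where

open import Defs renaming (refl to ≤T-refl; trans to ≤T-trans)

open import Data.Bool using (true; false; if_then_else_)
open import Data.Fin using () renaming (zero to fzero; suc to fsuc)
open import Data.List
  using (List; []; _∷_; _++_; [_]; length; map; filter; upTo; concat; intercalate)
import Data.List.Properties as List
open import Data.List.Membership.Propositional using (_∈_; _∉_)
open import Data.List.Membership.Propositional.Properties
  using (∈-map⁺; ∈-map⁻; ∈-++⁺ˡ; ∈-++⁺ʳ; ∈-++⁻; ∈-∃++; ∈-lookup)
open import Data.List.Relation.Binary.Pointwise using (Pointwise; []; _∷_)
open import Data.List.Relation.Binary.Sublist.Propositional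
  using (_⊆_; []; _∷_; _∷ʳ_; minimum)
open import Data.List.Relation.Binary.Sublist.Propositional.Properties
  using (Any-resp-⊆; All-resp-⊆; length-mono-≤)
open import Data.List.Relation.Unary.All as All using (All; []; _∷_)
import Data.List.Relation.Unary.All.Properties as All
import Data.List.Relation.Unary.Any as Any
open import Data.List.Relation.Unary.Any using (here; there)
open import Data.List.Relation.Unary.Any.Properties using (lookup-index)
open import Data.Nat
  using ( ℕ; zero; suc; pred; _+_; _∸_; _≤_; _<_; _≤ᵇ_; _≡ᵇ_; z≤n; s≤s; z<s
        ; _≤′_; ≤′-refl; ≤′-step)
open import Data.Nat.ListAction using (sum)
open import Data.Nat.Properties
open import Data.List.Membership.DecPropositional _≟_ using (_∈?_)
open import Data.Product using (Σ; ∃₂; _×_; _,_; proj₁; proj₂)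
import Data.Sum
open import Data.Sum using (_⊎_; inj₁; inj₂; [_,_]′)
open import Function using (_∘_; id; flip)
open import Function.Bundles using (_⇔_; mk⇔; Equivalence)
open import Relation.Binary.Core using (_Preserves_⟶_)
open import Relation.Binary.Construct.Closure.ReflexiveTransitive as Star
  using (ε; _◅_; _◅◅_)
open import Relation.Binary.Definitions using (tri<; tri≈; tri>)
open import Relation.Binary.PropositionalEquality hiding ([_])
open import Relation.Nullary using (¬_; yes; no; contradiction; proof)
open import Relation.Nullary.Decidable using (_×-dec_)
open import Relation.Nullary.Reflects using (Reflects; ofʸ; ofⁿ)

≡ᵇ-reflects-≡ : ∀ m n → Reflects (m ≡ n) (m ≡ᵇ n)
≡ᵇ-reflects-≡ m n = proof (m ≟ n)

-- Defs.merge i is definitionally map (mergeVal i).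
mergeVal : ℕ → ℕ → ℕ
mergeVal i j = if j ≤ᵇ i then j else j ∸ 1

mergeVal-≤ : ∀ {i j} → j ≤ i → mergeVal i j ≡ j
mergeVal-≤ {i} {j} j≤i with j ≤ᵇ i | ≤ᵇ-reflects-≤ j i
... | true  | _       = refl
... | false | ofⁿ j≰i = contradiction j≤i j≰i

mergeVal-suc : ∀ {i j} → i ≤ j → mergeVal i (suc j) ≡ j
mergeVal-suc {i} {j} i≤j with suc j ≤ᵇ i | ≤ᵇ-reflects-≤ (suc j) i
... | true  | ofʸ j<i = contradiction i≤j (<⇒≱ j<i)
... | false | _       = refl

mergeVal-1+i : ∀ i → mergeVal i (suc i) ≡ i
mergeVal-1+i i = mergeVal-suc ≤-refl

mergeVal-pred : ∀ {i x} → i < x → mergeVal i x ≡ pred x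
mergeVal-pred {x = suc x} (s≤s i≤x) = mergeVal-suc i≤x

data MergeView (i : ℕ) : ℕ → Set where
  below : ∀ {x} → x ≤ i → MergeView i x
  above : ∀ {x} → i ≤ x → MergeView i (suc x)

mergeView : ∀ i x → MergeView i x
mergeView i x with x ≤? i
... | yes x≤i = below x≤i
mergeView i zero    | no 0≰i = contradiction z≤n 0≰i
mergeView i (suc x) | no x≮i = above (≤-pred (≰⇒> x≮i))

mergeVal-mono : ∀ i → (mergeVal i) Preserves _≤_ ⟶ _≤_
mergeVal-mono i {x} {y} x≤y with mergeView i x | mergeView i y
... | below x≤i | below y≤i rewrite mergeVal-≤ x≤i | mergeVal-≤ y≤i     = x≤y
... | below x≤i | above i≤y rewrite mergeVal-≤ x≤i | mergeVal-suc i≤y   = ≤-trans x≤i i≤y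
... | above i≤x | below y≤i = contradiction (≤-trans x≤y y≤i) (<⇒≱ (s≤s i≤x))
... | above i≤x | above i≤y rewrite mergeVal-suc i≤x | mergeVal-suc i≤y = ≤-pred x≤y

mergeVal-strict : ∀ {i x y} → x < y → ¬ (x ≡ i × y ≡ suc i) → mergeVal i x < mergeVal i y
mergeVal-strict {i} {x} {y} x<y not-merged with mergeView i x | mergeView i y
... | below x≤i | below y≤i rewrite mergeVal-≤ x≤i | mergeVal-≤ y≤i     = x<y
... | above i≤x | below y≤i = contradiction (≤-trans (<⇒≤ x<y) y≤i) (<⇒≱ (s≤s i≤x))
... | above i≤x | above i≤y rewrite mergeVal-suc i≤x | mergeVal-suc i≤y = ≤-pred x<y
... | below x≤i | above i≤y rewrite mergeVal-≤ x≤i | mergeVal-suc i≤y with m≤n⇒m<n∨m≡n x≤i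
...   | inj₁ x<i  = ≤-trans x<i i≤y
...   | inj₂ refl = ≤∧≢⇒< i≤y λ { refl → not-merged (refl , refl) }

mergeVal-bound : ∀ {i r x} → i ≤ r → x ≤ suc r → mergeVal i x ≤ r
mergeVal-bound {i} i≤r x≤1+r = ≤-trans (mergeVal-mono i x≤1+r) (≤-reflexive (mergeVal-suc i≤r))

mergeVal-≡-inv : ∀ {i x r} → mergeVal i x ≡ r → (x ≤ i × x ≡ r) ⊎ x ≡ suc r
mergeVal-≡-inv {i} {x} refl with mergeView i x
... | below x≤i rewrite mergeVal-≤ x≤i   = inj₁ (x≤i , refl)
... | above i≤x rewrite mergeVal-suc i≤x = inj₂ refl

mergeVal-≡-i : ∀ {i x} → x ≢ i → mergeVal i x ≡ i ⇔ x ≡ suc i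
mergeVal-≡-i {i} {x} x≢i = mk⇔ to λ { refl → mergeVal-1+i i }
  where
  to : mergeVal i x ≡ i → x ≡ suc i
  to eq with mergeVal-≡-inv {i} {x} eq
  ... | inj₁ (_ , x≡i) = contradiction x≡i x≢i
  ... | inj₂ x≡1+i     = x≡1+i

mergeVal-≡-above : ∀ {i r x} → i < r → mergeVal i x ≡ r ⇔ x ≡ suc r
mergeVal-≡-above {i} {r} {x} i<r = mk⇔ to λ { refl → mergeVal-suc (<⇒≤ i<r) }
  where
  to : mergeVal i x ≡ r → x ≡ suc r
  to eq with mergeVal-≡-inv {i} {x} eq
  ... | inj₁ (x≤i , refl) = contradiction i<r (≤⇒≯ x≤i)
  ... | inj₂ x≡1+r        = x≡1+r

mergeVal-shift : ∀ c i x → mergeVal (c + i) (c + x) ≡ c + mergeVal i x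
mergeVal-shift c i x with mergeView i x
... | below x≤i rewrite mergeVal-≤ x≤i = mergeVal-≤ (+-monoʳ-≤ c x≤i)
... | above {x′} i≤x rewrite mergeVal-suc i≤x | +-suc c x′ = mergeVal-suc (+-monoʳ-≤ c i≤x)

merge-identity : ∀ {i w} → All (_≤ i) w → merge i w ≡ w
merge-identity w≤i = List.map-id-local (All.map mergeVal-≤ w≤i)

merge-++-suc : ∀ i u v → merge i (u ++ suc i ∷ v) ≡ merge i u ++ i ∷ merge i v
merge-++-suc i u v = trans (List.map-++ (mergeVal i) u (suc i ∷ v))
                           (cong (λ x → merge i u ++ x ∷ merge i v) (mergeVal-1+i i))

All-≤-pred : ∀ {r w} → All (_≤ suc r) w → suc r ∉ w → All (_≤ r) w
All-≤-pred []         _       = []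
All-≤-pred (x≤ ∷ xs≤) 1+r∉xxs =
  ≤-pred (≤∧≢⇒< x≤ λ { refl → 1+r∉xxs (here refl) }) ∷ All-≤-pred xs≤ (1+r∉xxs ∘ there)

maxW-upper : ∀ w → All (_≤ maxW w) w
maxW-upper []       = []
maxW-upper (x ∷ xs) =
  m≤m⊔n x (maxW xs) ∷ All.map (λ y≤m → ≤-trans y≤m (m≤n⊔m x (maxW xs))) (maxW-upper xs)

maxW-least : ∀ {m} w → All (_≤ m) w → maxW w ≤ m
maxW-least []       []           = z≤n
maxW-least (x ∷ xs) (x≤m ∷ xs≤m) = ⊔-lub x≤m (maxW-least xs xs≤m)

maxW-∈ : ∀ x xs → maxW (x ∷ xs) ∈ x ∷ xs
maxW-∈ x []       = here (⊔-identityʳ x)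
maxW-∈ x (y ∷ ys) with ≤-total x (maxW (y ∷ ys))
... | inj₁ x≤m rewrite m≤n⇒m⊔n≡n x≤m = there (maxW-∈ y ys)
... | inj₂ m≤x rewrite m≥n⇒m⊔n≡m m≤x = here refl

∈⇒maxW-∈ : ∀ {w y} → y ∈ w → maxW w ∈ w
∈⇒maxW-∈ {x ∷ xs} _ = maxW-∈ x xs

maxW-unique : ∀ {m w} → m ∈ w → All (_≤ m) w → maxW w ≡ m
maxW-unique {w = w} m∈w w≤m = ≤-antisym (maxW-least w w≤m) (All.lookup (maxW-upper w) m∈w)

maxW-map : ∀ {f : ℕ → ℕ} x xs → (∀ {y z} → y ∈ x ∷ xs → z ∈ x ∷ xs → y ≤ z → f y ≤ f z) →
           maxW (map f (x ∷ xs)) ≡ f (maxW (x ∷ xs))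
maxW-map {f} x xs f-mono = maxW-unique (∈-map⁺ f (maxW-∈ x xs)) (All.map⁺ (All.tabulate λ y∈w →
  f-mono y∈w (maxW-∈ x xs) (All.lookup (maxW-upper (x ∷ xs)) y∈w)))

merge-maxW : ∀ {i m} u → maxW u ≡ suc m → i < suc m → maxW (merge i u) ≡ m
merge-maxW         []       () _
merge-maxW {i} {m} (x ∷ xs) max≡ i<max = begin
  maxW (merge i (x ∷ xs))    ≡⟨ maxW-map x xs (λ _ _ → mergeVal-mono i) ⟩
  mergeVal i (maxW (x ∷ xs)) ≡⟨ cong (mergeVal i) max≡ ⟩
  mergeVal i (suc m)         ≡⟨ mergeVal-suc (≤-pred i<max) ⟩
  m                          ∎
  where open ≡-Reasoning

StrictMonoOn : List ℕ → (ℕ → ℕ) → Set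
StrictMonoOn w f = ∀ {x y} → x ∈ w → y ∈ w → x < y → f x < f y

module _ {w : List ℕ} {f : ℕ → ℕ} (f-mono : StrictMonoOn w f) where

  StrictMonoOn⇒MonoOn : ∀ {x y} → x ∈ w → y ∈ w → x ≤ y → f x ≤ f y
  StrictMonoOn⇒MonoOn x∈w y∈w x≤y with m≤n⇒m<n∨m≡n x≤y
  ... | inj₁ x<y  = <⇒≤ (f-mono x∈w y∈w x<y)
  ... | inj₂ refl = ≤-refl

  StrictMonoOn⇒InjectiveOn : ∀ {x y} → x ∈ w → y ∈ w → f x ≡ f y → x ≡ y
  StrictMonoOn⇒InjectiveOn {x} {y} x∈w y∈w fx≡fy with <-cmp x y
  ... | tri< x<y _ _ = contradiction fx≡fy (<⇒≢ (f-mono x∈w y∈w x<y))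
  ... | tri≈ _ x≡y _ = x≡y
  ... | tri> _ _ y<x = contradiction (sym fx≡fy) (<⇒≢ (f-mono y∈w x∈w y<x))

  StrictMonoOn-⊆ : ∀ {v} → v ⊆ w → StrictMonoOn v f
  StrictMonoOn-⊆ v⊆w x∈v y∈v = f-mono (Any-resp-⊆ v⊆w x∈v) (Any-resp-⊆ v⊆w y∈v)

All-≢⇒∉ : ∀ {v : ℕ} {w} → All (_≢ v) w → v ∉ w
All-≢⇒∉ w≢v v∈w = All.lookup w≢v v∈w refl

∈-++-∷⁻ : ∀ {x y : ℕ} u {v} → x ∈ u ++ y ∷ v → x ≢ y → x ∈ u ⊎ x ∈ v
∈-++-∷⁻ u x∈w x≢y with ∈-++⁻ u x∈w
... | inj₁ x∈u         = inj₁ x∈u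
... | inj₂ (here x≡y)  = contradiction x≡y x≢y
... | inj₂ (there x∈v) = inj₂ x∈v

∈-∃++-first : ∀ {v : ℕ} {w} → v ∈ w → ∃₂ λ u u′ → w ≡ u ++ v ∷ u′ × v ∉ u
∈-∃++-first {v} {x ∷ w} v∈w with x ≟ v | v∈w
... | yes refl | _          = [] , w , refl , λ ()
... | no x≢v   | here v≡x   = contradiction (sym v≡x) x≢v
... | no x≢v   | there v∈w′ with ∈-∃++-first v∈w′
...   | u , u′ , refl , v∉u =
  x ∷ u , u′ , refl , λ { (here v≡x) → x≢v (sym v≡x) ; (there v∈u) → v∉u v∈u }

∈-∃++-last : ∀ {v : ℕ} {w} → v ∈ w → ∃₂ λ u u′ → w ≡ u ++ v ∷ u′ × v ∉ u′
∈-∃++-last {v} {x ∷ w} v∈w with v ∈? w | v∈w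
... | no v∉w   | here refl  = [] , w , refl , v∉w
... | no v∉w   | there v∈w′ = contradiction v∈w′ v∉w
... | yes v∈w′ | _ with ∈-∃++-last v∈w′
...   | u , u′ , refl , v∉u′ = x ∷ u , u′ , refl , v∉u′

⊆-∉-shorter : ∀ {r : ℕ} {p w} → p ⊆ w → r ∉ p → r ∈ w → length p < length w
⊆-∉-shorter (x ∷ʳ p⊆w)   r∉p r∈w         = s≤s (length-mono-≤ p⊆w)
⊆-∉-shorter (refl ∷ p⊆w) r∉p (here refl) = contradiction (here refl) r∉p
⊆-∉-shorter (refl ∷ p⊆w) r∉p (there r∈w) = s≤s (⊆-∉-shorter p⊆w (r∉p ∘ there) r∈w)

module _ {A : Set} where

  intercalate-All : ∀ {P : A → Set} {xs} yss → All P xs → All P (concat yss) →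
                    All P (intercalate xs yss)
  intercalate-All []              _   _   = []
  intercalate-All (ys ∷ [])       _   pys = All.++⁻ˡ ys pys
  intercalate-All (ys ∷ zs ∷ yss) pxs pys =
    All.++⁺ (All.++⁻ˡ ys pys) (All.++⁺ pxs (intercalate-All (zs ∷ yss) pxs (All.++⁻ʳ ys pys)))

  ∈-intercalate⁺ : ∀ {x : A} {xs} yss → x ∈ concat yss → x ∈ intercalate xs yss
  ∈-intercalate⁺ (ys ∷ [])       x∈ = subst (_ ∈_) (List.++-identityʳ ys) x∈
  ∈-intercalate⁺ (ys ∷ zs ∷ yss) x∈ =
    [ ∈-++⁺ˡ , ∈-++⁺ʳ ys ∘ ∈-++⁺ʳ _ ∘ ∈-intercalate⁺ (zs ∷ yss) ]′ (∈-++⁻ ys x∈)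

  ∈-intercalate-sep : ∀ {x : A} {xs} yss → x ∈ xs → 2 ≤ length yss → x ∈ intercalate xs yss
  ∈-intercalate-sep (ys ∷ _ ∷ _) x∈xs _        = ∈-++⁺ʳ ys (∈-++⁺ˡ x∈xs)
  ∈-intercalate-sep (_ ∷ [])     _    (s≤s ())

  ∈-intercalate⁻ : ∀ {x : A} xs yss → x ∈ intercalate xs yss → x ∈ xs ⊎ x ∈ concat yss
  ∈-intercalate⁻ xs (ys ∷ [])       x∈ = inj₂ (subst (_ ∈_) (sym (List.++-identityʳ ys)) x∈)
  ∈-intercalate⁻ xs (ys ∷ zs ∷ yss) x∈ =
    [ inj₂ ∘ ∈-++⁺ˡ
    , [ inj₁ , Data.Sum.map₂ (∈-++⁺ʳ ys) ∘ ∈-intercalate⁻ xs (zs ∷ yss) ]′ ∘ ∈-++⁻ xs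
    ]′ (∈-++⁻ ys x∈)

  map-intercalate : ∀ {B : Set} (f : A → B) xs yss →
                    map f (intercalate xs yss) ≡ intercalate (map f xs) (map (map f) yss)
  map-intercalate f xs []              = refl
  map-intercalate f xs (ys ∷ [])       = refl
  map-intercalate f xs (ys ∷ zs ∷ yss) = begin
    map f (ys ++ xs ++ intercalate xs (zs ∷ yss))
      ≡⟨ List.map-++ f ys _ ⟩
    map f ys ++ map f (xs ++ intercalate xs (zs ∷ yss))
      ≡⟨ cong (map f ys ++_) (List.map-++ f xs _) ⟩
    map f ys ++ map f xs ++ map f (intercalate xs (zs ∷ yss))
      ≡⟨ cong (λ l → map f ys ++ map f xs ++ l) (map-intercalate f xs (zs ∷ yss)) ⟩
    map f ys ++ map f xs ++ intercalate (map f xs) (map (map f) (zs ∷ yss)) ∎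
    where open ≡-Reasoning

  intercalate-++ : ∀ (xs ys : List A) yss zs zss →
                   intercalate xs ((ys ∷ yss) ++ zs ∷ zss) ≡
                   intercalate xs (ys ∷ yss) ++ xs ++ intercalate xs (zs ∷ zss)
  intercalate-++ xs ys []          zs zss = refl
  intercalate-++ xs ys (ys′ ∷ yss) zs zss = begin
    ys ++ xs ++ intercalate xs ((ys′ ∷ yss) ++ zs ∷ zss)
      ≡⟨ cong (λ l → ys ++ xs ++ l) (intercalate-++ xs ys′ yss zs zss) ⟩
    ys ++ xs ++ (front ++ xs ++ back)
      ≡⟨ cong (ys ++_) (List.++-assoc xs front (xs ++ back)) ⟨
    ys ++ (xs ++ front) ++ xs ++ back
      ≡⟨ List.++-assoc ys (xs ++ front) (xs ++ back) ⟨
    (ys ++ xs ++ front) ++ xs ++ back ∎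
    where
    open ≡-Reasoning
    front back : List A
    front = intercalate xs (ys′ ∷ yss)
    back = intercalate xs (zs ∷ zss)

  intercalate-nested : ∀ (xs : List A) yss zs zss →
                       intercalate xs (yss ++ [ intercalate xs (zs ∷ zss) ]) ≡ intercalate xs (yss ++ zs ∷ zss)
  intercalate-nested xs []         zs zss = refl
  intercalate-nested xs (ys ∷ yss) zs zss =
    trans (intercalate-++ xs ys yss (intercalate xs (zs ∷ zss)) []) (sym (intercalate-++ xs ys yss zs zss))

  length-intercalate : ∀ (x : A) ys yss →
                       suc (length (intercalate [ x ] (ys ∷ yss))) ≡ sum (map (λ zs → suc (length zs)) (ys ∷ yss))
  length-intercalate x ys []          = cong suc (sym (+-identityʳ (length ys)))
  length-intercalate x ys (ys′ ∷ yss) = cong suc (begin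
    length (ys ++ x ∷ intercalate [ x ] (ys′ ∷ yss))         ≡⟨ List.length-++ ys ⟩
    length ys + suc (length (intercalate [ x ] (ys′ ∷ yss)))
      ≡⟨ cong (length ys +_) (length-intercalate x ys′ yss) ⟩
    length ys + sum (map (λ zs → suc (length zs)) (ys′ ∷ yss)) ∎)
    where open ≡-Reasoning

consHead : ℕ → List (List ℕ) → List (List ℕ)
consHead x []       = []
consHead x (s ∷ ss) = (x ∷ s) ∷ ss

splitOn : ℕ → List ℕ → List (List ℕ)
splitOn r []       = [] ∷ []
splitOn r (x ∷ xs) = if x ≡ᵇ r then [] ∷ splitOn r xs else consHead x (splitOn r xs)

splitOn-nonempty : ∀ r w → ∃₂ λ s ss → splitOn r w ≡ s ∷ ss
splitOn-nonempty r []       = [] , [] , refl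
splitOn-nonempty r (x ∷ xs) with x ≡ᵇ r | splitOn-nonempty r xs
... | true  | _                      = [] , splitOn r xs , refl
... | false | s , ss , eq rewrite eq = x ∷ s , ss , refl

splitAtVal≡splitOn : ∀ r w → splitAtVal r w ≡ splitOn r w
splitAtVal≡splitOn r []       = refl
splitAtVal≡splitOn r (x ∷ xs) with splitAtVal r xs | splitAtVal≡splitOn r xs | splitOn-nonempty r xs
... | s ∷ ss | eq | _ rewrite sym eq = refl
... | []     | eq | _ , _ , eq′ with () ← trans eq eq′

splitOn-∉ : ∀ {r w} → r ∉ w → splitOn r w ≡ [ w ]
splitOn-∉ {r} {[]}     r∉w = refl
splitOn-∉ {r} {x ∷ xs} r∉w with x ≡ᵇ r | ≡ᵇ-reflects-≡ x r
... | true  | ofʸ refl = contradiction (here refl) r∉w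
... | false | _ rewrite splitOn-∉ {r} {xs} (r∉w ∘ there) = refl

splitOn-++ : ∀ r u v → splitOn r (u ++ r ∷ v) ≡ splitOn r u ++ splitOn r v
splitOn-++ r []      v with r ≡ᵇ r | ≡ᵇ-reflects-≡ r r
... | true  | _       = refl
... | false | ofⁿ r≢r = contradiction refl r≢r
splitOn-++ r (x ∷ u) v with x ≡ᵇ r
... | true  = cong ([] ∷_) (splitOn-++ r u v)
... | false with splitOn-nonempty r u
...   | s , ss , eq rewrite splitOn-++ r u v | eq = refl

map-consHead : ∀ (f : ℕ → ℕ) x ss → map (map f) (consHead x ss) ≡ consHead (f x) (map (map f) ss)
map-consHead f x []      = refl
map-consHead f x (_ ∷ _) = refl

splitOn-map : ∀ (f : ℕ → ℕ) {s r} w → (∀ {x} → x ∈ w → f x ≡ s ⇔ x ≡ r) →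
              splitOn s (map f w) ≡ map (map f) (splitOn r w)
splitOn-map f         []       f≡s⇔≡r = refl
splitOn-map f {s} {r} (x ∷ xs) f≡s⇔≡r
  with f x ≡ᵇ s | ≡ᵇ-reflects-≡ (f x) s | x ≡ᵇ r | ≡ᵇ-reflects-≡ x r
     | splitOn-map f xs (f≡s⇔≡r ∘ there)
... | true  | _        | true  | _       | eq = cong ([] ∷_) eq
... | false | _        | false | _       | eq rewrite eq = sym (map-consHead f x (splitOn r xs))
... | true  | ofʸ fx≡s | false | ofⁿ x≢r | _  =
  contradiction (Equivalence.to (f≡s⇔≡r (here refl)) fx≡s) x≢r
... | false | ofⁿ fx≢s | true  | ofʸ x≡r | _  =
  contradiction (Equivalence.from (f≡s⇔≡r (here refl)) x≡r) fx≢s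

splitOn-⊆ : ∀ r w → All (_⊆ w) (splitOn r w)
splitOn-⊆ r []       = [] ∷ []
splitOn-⊆ r (x ∷ xs) with x ≡ᵇ r
... | true  = minimum _ ∷ All.map (x ∷ʳ_) (splitOn-⊆ r xs)
... | false with splitOn r xs | splitOn-⊆ r xs
...   | []     | []            = []
...   | s ∷ ss | s⊆xs ∷ ss⊆xs = (refl ∷ s⊆xs) ∷ All.map (x ∷ʳ_) ss⊆xs

splitOn-∌ : ∀ r w → All (r ∉_) (splitOn r w)
splitOn-∌ r []       = (λ ()) ∷ []
splitOn-∌ r (x ∷ xs) with x ≡ᵇ r | ≡ᵇ-reflects-≡ x r
... | true  | _       = (λ ()) ∷ splitOn-∌ r xs
... | false | ofⁿ x≢r with splitOn r xs | splitOn-∌ r xs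
...   | []     | []          = []
...   | s ∷ ss | r∉s ∷ r∉ss = (λ { (here refl) → x≢r refl ; (there r∈s) → r∉s r∈s }) ∷ r∉ss

splitOn-shorter : ∀ {r w} → r ∈ w → All (λ p → length p < length w) (splitOn r w)
splitOn-shorter {r} {w} r∈w =
  All.zipWith (λ (p⊆w , r∉p) → ⊆-∉-shorter p⊆w r∉p r∈w) (splitOn-⊆ r w , splitOn-∌ r w)

splitOn-length : ∀ {r w} → r ∈ w → 2 ≤ length (splitOn r w)
splitOn-length {r} r∈w with ∈-∃++ r∈w
... | u , v , refl rewrite splitOn-++ r u v with splitOn-nonempty r u | splitOn-nonempty r v
...   | s , ss , eq | s′ , ss′ , eq′ rewrite eq | eq′ | List.length-++ ss {s′ ∷ ss′} =
  s≤s (≤-trans (s≤s z≤n) (m≤n+m (suc (length ss′)) (length ss)))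

splitOn-intercalate : ∀ {s} p ps → All (s ∉_) (p ∷ ps) → splitOn s (intercalate [ s ] (p ∷ ps)) ≡ p ∷ ps
splitOn-intercalate     p []       (s∉p ∷ [])   = splitOn-∉ s∉p
splitOn-intercalate {s} p (q ∷ qs) (s∉p ∷ s∉qs)
  rewrite splitOn-++ s p (intercalate [ s ] (q ∷ qs)) | splitOn-∉ s∉p | splitOn-intercalate q qs s∉qs = refl

splitOn-merge-max : ∀ {i v} → i ∉ v → All (_≤ suc i) v → splitOn i (merge i v) ≡ splitOn (suc i) v
splitOn-merge-max {i} {v} i∉v v≤1+i = begin
  splitOn i (merge i v)
    ≡⟨ splitOn-map (mergeVal i) v (λ x∈v → mergeVal-≡-i λ { refl → i∉v x∈v }) ⟩
  map (merge i) (splitOn (suc i) v)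
    ≡⟨ List.map-id-local (All.zipWith
         (λ (p⊆v , 1+i∉p) → merge-identity (All-≤-pred (All-resp-⊆ p⊆v v≤1+i) 1+i∉p))
                                      (splitOn-⊆ (suc i) v , splitOn-∌ (suc i) v)) ⟩
  splitOn (suc i) v ∎
  where open ≡-Reasoning

rank-suc : ∀ w x → rank w (suc x) ≡ rank w x + length (filter (_∈? w) [ suc x ])
rank-suc w x = begin
  length (filter (_∈? w) (map suc (upTo (suc x))))
    ≡⟨ cong (λ l → length (filter (_∈? w) (map suc l))) (List.upTo-∷ʳ x) ⟨
  length (filter (_∈? w) (map suc (upTo x ++ [ x ])))
    ≡⟨ cong (length ∘ filter (_∈? w)) (List.map-++ suc (upTo x) [ x ]) ⟩
  length (filter (_∈? w) (map suc (upTo x) ++ [ suc x ]))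
    ≡⟨ cong length (List.filter-++ (_∈? w) (map suc (upTo x)) [ suc x ]) ⟩
  length (filter (_∈? w) (map suc (upTo x)) ++ filter (_∈? w) [ suc x ])
    ≡⟨ List.length-++ (filter (_∈? w) (map suc (upTo x))) ⟩
  rank w x + length (filter (_∈? w) [ suc x ]) ∎
  where open ≡-Reasoning

rank-mono : ∀ w → (rank w) Preserves _≤_ ⟶ _≤_
rank-mono w x≤y = go (≤⇒≤′ x≤y)
  where
  go : ∀ {x y} → x ≤′ y → rank w x ≤ rank w y
  go ≤′-refl                = ≤-refl
  go (≤′-step {y} x≤′y) = ≤-trans (go x≤′y) (≤-trans (m≤m+n _ _) (≤-reflexive (sym (rank-suc w y))))

rank-strictMonoOn : ∀ w → StrictMonoOn w (rank w)
rank-strictMonoOn w {x} {suc y} _ 1+y∈w (s≤s x≤y) = begin-strict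
  rank w x                                     ≤⟨ rank-mono w x≤y ⟩
  rank w y                                     <⟨ n<1+n _ ⟩
  suc (rank w y)                               ≡⟨ +-comm 1 (rank w y) ⟩
  rank w y + 1
    ≡⟨ cong (λ l → rank w y + length l) (List.filter-accept (_∈? w) 1+y∈w) ⟨
  rank w y + length (filter (_∈? w) [ suc y ]) ≡⟨ rank-suc w y ⟨
  rank w (suc y)                               ∎
  where open ≤-Reasoning

-- Γ without the relabelling std of the blocks, which Γ′-invariant shows to be irrelevant.
Γ′ : ℕ → List ℕ → Tree
Γ′ zero    w        = leaf
Γ′ (suc n) []       = leaf
Γ′ (suc n) (x ∷ xs) = node (map (Γ′ n) (splitOn (maxW (x ∷ xs)) (x ∷ xs)))

Γ′-invariant : ∀ n {f} w → StrictMonoOn w f → Γ′ n (map f w) ≡ Γ′ n w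
Γ′-invariant zero    []           f-mono = refl
Γ′-invariant zero    (_ ∷ _)      f-mono = refl
Γ′-invariant (suc n) []           f-mono = refl
Γ′-invariant (suc n) {f} (x ∷ xs) f-mono = cong node (begin
  map (Γ′ n) (splitOn (maxW (map f w)) (map f w))
    ≡⟨ cong (λ r → map (Γ′ n) (splitOn r (map f w))) (maxW-map x xs (StrictMonoOn⇒MonoOn f-mono)) ⟩
  map (Γ′ n) (splitOn (f m) (map f w))
    ≡⟨ cong (map (Γ′ n)) (splitOn-map f w λ y∈w →
         mk⇔ (StrictMonoOn⇒InjectiveOn f-mono y∈w (maxW-∈ x xs)) (cong f)) ⟩
  map (Γ′ n) (map (map f) (splitOn m w))
    ≡⟨ List.map-∘ (splitOn m w) ⟨
  map (Γ′ n ∘ map f) (splitOn m w)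
    ≡⟨ List.map-cong-local
         (All.map (λ p⊆w → Γ′-invariant n _ (StrictMonoOn-⊆ f-mono p⊆w)) (splitOn-⊆ m w)) ⟩
  map (Γ′ n) (splitOn m w) ∎)
  where
  open ≡-Reasoning
  w : List ℕ
  w = x ∷ xs
  m : ℕ
  m = maxW w

Γf≡Γ′ : ∀ n w → Γf n w ≡ Γ′ n w
Γf≡Γ′ zero    w        = refl
Γf≡Γ′ (suc n) []       = refl
Γf≡Γ′ (suc n) (x ∷ xs) rewrite splitAtVal≡splitOn (maxW (x ∷ xs)) (x ∷ xs) =
  cong node (List.map-cong (λ s → trans (Γf≡Γ′ n (std s)) (Γ′-invariant n s (rank-strictMonoOn s))) _)

Γ′-fuel : ∀ {m n} w → length w < m → length w < n → Γ′ m w ≡ Γ′ n w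
Γ′-fuel {suc m} {suc n} []       _         _         = refl
Γ′-fuel {suc m} {suc n} (x ∷ xs) (s≤s w<m) (s≤s w<n) = cong node (List.map-cong-local (All.map
  (λ p<w → Γ′-fuel _ (<-≤-trans p<w w<m) (<-≤-trans p<w w<n)) (splitOn-shorter (maxW-∈ x xs))))

Γ≡Γ′ : ∀ w → Γ w ≡ Γ′ (suc (length w)) w
Γ≡Γ′ w = Γf≡Γ′ _ w

Γ-unfold : ∀ {r w} → r ∈ w → All (_≤ r) w → Γ w ≡ node (map Γ (splitOn r w))
Γ-unfold {r} {x ∷ xs} r∈w w≤r rewrite Γ≡Γ′ (x ∷ xs) | maxW-unique r∈w w≤r =
  cong node (List.map-cong-local (All.map (λ p<w → sym (trans (Γ≡Γ′ _) (Γ′-fuel _ ≤-refl p<w)))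
                                          (splitOn-shorter r∈w)))

Γ-unfold-++ : ∀ {r} u v → All (_≤ r) (u ++ r ∷ v) →
              Γ (u ++ r ∷ v) ≡ node (map Γ (splitOn r u) ++ map Γ (splitOn r v))
Γ-unfold-++ {r} u v w≤r = begin
  Γ (u ++ r ∷ v)                                    ≡⟨ Γ-unfold (∈-++⁺ʳ u (here refl)) w≤r ⟩
  node (map Γ (splitOn r (u ++ r ∷ v)))             ≡⟨ cong (node ∘ map Γ) (splitOn-++ r u v) ⟩
  node (map Γ (splitOn r u ++ splitOn r v))         ≡⟨ cong node (List.map-++ Γ (splitOn r u) (splitOn r v)) ⟩
  node (map Γ (splitOn r u) ++ map Γ (splitOn r v)) ∎
  where open ≡-Reasoning

Γ-invariant : ∀ {f} w → StrictMonoOn w f → Γ (map f w) ≡ Γ w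
Γ-invariant {f} w f-mono rewrite Γ≡Γ′ (map f w) | Γ≡Γ′ w | List.length-map f w = Γ′-invariant _ w f-mono

Γ′-valid : ∀ n w → Valid (Γ′ n w)
Γ′-valid zero    w        = leaf
Γ′-valid (suc n) []       = leaf
Γ′-valid (suc n) (x ∷ xs) = node
  (subst (2 ≤_) (sym (List.length-map (Γ′ n) (splitOn _ (x ∷ xs)))) (splitOn-length (maxW-∈ x xs)))
  (All.map⁺ (All.universal (Γ′-valid n) _))

Γ-valid : ∀ w → Valid (Γ w)
Γ-valid w = subst Valid (sym (Γ≡Γ′ w)) (Γ′-valid _ w)

Γ-valid-all : ∀ ps → All Valid (map Γ ps)
Γ-valid-all ps = All.map⁺ (All.universal Γ-valid ps)

Γ-splitOn-length : ∀ {r w} → r ∈ w → 2 ≤ length (map Γ (splitOn r w))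
Γ-splitOn-length {r} {w} r∈w = subst (2 ≤_) (sym (List.length-map Γ (splitOn r w))) (splitOn-length r∈w)

Γ-splitOn-nonempty : ∀ r w → 1 ≤ length (map Γ (splitOn r w))
Γ-splitOn-nonempty r w with splitOn-nonempty r w
... | _ , _ , eq rewrite eq = s≤s z≤n

-- Inductive form of Before w a b: no b occurs before the last a.
data Precedes (a b : ℕ) : List ℕ → Set where
  done : ∀ {w} → a ∉ w → Precedes a b w
  step : ∀ {x w} → x ≢ b → Precedes a b w → Precedes a b (x ∷ w)

Before⇒Precedes : ∀ {a b} w → a ≢ b → Before w a b → Precedes a b w
Before⇒Precedes []       a≢b before = done λ ()
Before⇒Precedes {a} {b} (x ∷ xs) a≢b before with x ≟ b
... | no x≢b   = step x≢b (Before⇒Precedes xs a≢b λ p q xp≡a xq≡b →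
                   ≤-pred (before (fsuc p) (fsuc q) xp≡a xq≡b))
... | yes refl = done λ
  { (here a≡x)   → a≢b a≡x
  ; (there a∈xs) → contradiction (before (fsuc (Any.index a∈xs)) fzero (sym (lookup-index a∈xs)) refl) λ ()
  }

Precedes⇒Before : ∀ {a b} w → Precedes a b w → Before w a b
Precedes⇒Before w        (done a∉w)       p        q        wp≡a wq≡b =
  contradiction (subst (_∈ w) wp≡a (∈-lookup p)) a∉w
Precedes⇒Before (x ∷ xs) (step x≢b a≺b) p        fzero    wp≡a wq≡b = contradiction wq≡b x≢b
Precedes⇒Before (x ∷ xs) (step x≢b a≺b) fzero    (fsuc q) wp≡a wq≡b = s≤s z≤n
Precedes⇒Before (x ∷ xs) (step x≢b a≺b) (fsuc p) (fsuc q) wp≡a wq≡b =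
  s≤s (Precedes⇒Before xs a≺b p q wp≡a wq≡b)

Precedes-⊆ : ∀ {a b p w} → p ⊆ w → Precedes a b w → Precedes a b p
Precedes-⊆ p⊆w          (done a∉w)     = done (a∉w ∘ Any-resp-⊆ p⊆w)
Precedes-⊆ (_ ∷ʳ p⊆w)   (step _ a≺b)   = Precedes-⊆ p⊆w a≺b
Precedes-⊆ (refl ∷ p⊆w) (step x≢b a≺b) = step x≢b (Precedes-⊆ p⊆w a≺b)

Precedes-after : ∀ {a b} u v → Precedes a b (u ++ b ∷ v) → a ∉ v
Precedes-after []      v (done a∉w)   = a∉w ∘ there
Precedes-after []      v (step b≢b _) = contradiction refl b≢b
Precedes-after (x ∷ u) v (done a∉w)   = a∉w ∘ there ∘ ∈-++⁺ʳ u ∘ there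
Precedes-after (x ∷ u) v (step _ a≺b) = Precedes-after u v a≺b

Precedes-before : ∀ {a b} u v → Precedes a b (u ++ a ∷ v) → b ∉ u
Precedes-before (x ∷ u) v (done a∉w)   _           = a∉w (there (∈-++⁺ʳ u (here refl)))
Precedes-before (x ∷ u) v (step x≢b _) (here refl) = x≢b refl
Precedes-before (x ∷ u) v (step _ a≺b) (there b∈u) = Precedes-before u v a≺b b∈u

Precedes-++ˡ : ∀ {a b} u {w} → b ∉ u → Precedes a b w → Precedes a b (u ++ w)
Precedes-++ˡ []      b∉u a≺b = a≺b
Precedes-++ˡ (x ∷ u) b∉u a≺b = step (λ { refl → b∉u (here refl) }) (Precedes-++ˡ u (b∉u ∘ there) a≺b)

Precedes-++ʳ : ∀ {a b} w {v} → a ∉ v → Precedes a b w → Precedes a b (w ++ v)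
Precedes-++ʳ w       a∉v (done a∉w)     = done ([ a∉w , a∉v ]′ ∘ ∈-++⁻ w)
Precedes-++ʳ (x ∷ w) a∉v (step x≢b a≺b) = step x≢b (Precedes-++ʳ w a∉v a≺b)

Precedes-split : ∀ {a b} u v → b ∉ u → a ∉ v → Precedes a b (u ++ v)
Precedes-split u v b∉u a∉v = Precedes-++ˡ u b∉u (done a∉v)

Precedes-map : ∀ {f : ℕ → ℕ} → (∀ {x y} → f x ≡ f y → x ≡ y) → ∀ {a b} w →
               Precedes a b w → Precedes (f a) (f b) (map f w)
Precedes-map {f} f-inj w (done a∉w) = done λ fa∈fw →
  let _ , x∈w , fa≡fx = ∈-map⁻ f fa∈fw in a∉w (subst (_∈ w) (sym (f-inj fa≡fx)) x∈w)
Precedes-map f-inj (x ∷ w) (step x≢b a≺b) = step (x≢b ∘ f-inj) (Precedes-map f-inj w a≺b)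

Precedes-intercalate-head : ∀ {a b} xs q qs → a ∉ xs → a ∉ concat qs → Precedes a b q →
                            Precedes a b (intercalate xs (q ∷ qs))
Precedes-intercalate-head xs q []        _    _    a≺b = a≺b
Precedes-intercalate-head xs q (q′ ∷ qs) a∉xs a∉qs a≺b =
  Precedes-++ʳ q ([ a∉xs , [ a∉xs , a∉qs ]′ ∘ ∈-intercalate⁻ xs (q′ ∷ qs) ]′ ∘ ∈-++⁻ xs) a≺b

Precedes-intercalate : ∀ {a b} xs ps q qs → a ∉ xs → b ∉ xs → b ∉ concat ps → a ∉ concat qs →
                       Precedes a b q → Precedes a b (intercalate xs (ps ++ q ∷ qs))
Precedes-intercalate xs []       q qs a∉xs _    _    a∉qs a≺b = Precedes-intercalate-head xs q qs a∉xs a∉qs a≺b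
Precedes-intercalate xs (p ∷ ps) q qs a∉xs b∉xs b∉ps a∉qs a≺b =
  subst (Precedes _ _) (sym (intercalate-++ xs p ps q qs))
    (Precedes-++ˡ (intercalate xs (p ∷ ps)) ([ b∉xs , b∉ps ]′ ∘ ∈-intercalate⁻ xs (p ∷ ps))
      (Precedes-++ˡ xs b∉xs (Precedes-intercalate-head xs q qs a∉xs a∉qs a≺b)))

-- Γ is monotone

≡⇒≤T : ∀ {t u} → t ≡ u → t ≤T u
≡⇒≤T refl = ≤T-refl

node-mono : ∀ {ts us} → 2 ≤ length ts → All Valid ts → All Valid us → Pointwise _≤T_ ts us →
            node ts ≤T node us
node-mono len ts-ok us-ok ts≤us = go [] len [] ts-ok us-ok ts≤us
  where
  go : ∀ ls {ts us} → 2 ≤ length ls + length ts → All Valid ls → All Valid ts → All Valid us →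
       Pointwise _≤T_ ts us → node (ls ++ ts) ≤T node (ls ++ us)
  go ls _ _ _ _ [] = ≤T-refl
  go ls {t ∷ ts} {u ∷ us} len ls-ok (t-ok ∷ ts-ok) (u-ok ∷ us-ok) (t≤u ∷ ts≤us) =
    ≤T-trans (rule1 len′ ls-ok ts-ok t-ok u-ok t≤u)
      (subst₂ (λ x y → node x ≤T node y) (List.++-assoc ls [ u ] ts) (List.++-assoc ls [ u ] us)
        (go (ls ++ [ u ]) (subst (2 ≤_) (sym len-eq) len) (All.++⁺ ls-ok (u-ok ∷ [])) ts-ok us-ok ts≤us))
    where
    len′ : 1 ≤ length ls + length ts
    len′ = ≤-pred (subst (2 ≤_) (+-suc (length ls) (length ts)) len)
    len-eq : length (ls ++ [ u ]) + length ts ≡ length ls + suc (length ts)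
    len-eq = trans (cong (_+ length ts) (List.length-++ ls)) (+-assoc (length ls) 1 (length ts))

node-map-mono : ∀ {A : Set} {f g : A → Tree} {ps} → 2 ≤ length ps →
                All (Valid ∘ f) ps → All (Valid ∘ g) ps → All (λ p → f p ≤T g p) ps →
                node (map f ps) ≤T node (map g ps)
node-map-mono {f = f} {g} {ps} len f-ok g-ok f≤g =
  node-mono (subst (2 ≤_) (sym (List.length-map f ps)) len) (All.map⁺ f-ok) (All.map⁺ g-ok) (pointwise f≤g)
  where
  pointwise : ∀ {qs} → All (λ p → f p ≤T g p) qs → Pointwise _≤T_ (map f qs) (map g qs)
  pointwise []       = []
  pointwise (h ∷ hs) = h ∷ pointwise hs

-- If i + 1 is the maximum, cutting at the first i + 1 shows that merging
-- dissolves the first subtree into the root: rule (2).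
Γ-merge-max-up : ∀ {i γ} → i ∈ γ → suc i ∈ γ → All (_≤ suc i) γ → Precedes i (suc i) γ →
                 Γ γ ≤T Γ (merge i γ)
Γ-merge-max-up {i} i∈γ 1+i∈γ γ≤1+i i≺1+i with ∈-∃++-first 1+i∈γ
... | u , v , refl , 1+i∉u =
  subst₂ _≤T_ (sym unfold-γ) (sym unfold-merge)
    (rule2 (Γ-splitOn-length i∈u) (Γ-splitOn-nonempty (suc i) v) (Γ-valid-all _) (Γ-valid-all _))
  where
  open ≡-Reasoning
  i∉v : i ∉ v
  i∉v = Precedes-after u v i≺1+i
  i∈u : i ∈ u
  i∈u = [ id , (λ i∈v → contradiction i∈v i∉v) ]′ (∈-++-∷⁻ u i∈γ (<⇒≢ (n<1+n i)))
  u≤i : All (_≤ i) u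
  u≤i = All-≤-pred (All.++⁻ˡ u γ≤1+i) 1+i∉u
  v≤1+i : All (_≤ suc i) v
  v≤1+i = All.tail (All.++⁻ʳ u γ≤1+i)
  unfold-γ : Γ (u ++ suc i ∷ v) ≡ node (node (map Γ (splitOn i u)) ∷ map Γ (splitOn (suc i) v))
  unfold-γ rewrite Γ-unfold-++ u v γ≤1+i | splitOn-∉ 1+i∉u | Γ-unfold i∈u u≤i = refl
  unfold-merge : Γ (merge i (u ++ suc i ∷ v)) ≡ node (map Γ (splitOn i u) ++ map Γ (splitOn (suc i) v))
  unfold-merge = begin
    Γ (merge i (u ++ suc i ∷ v))
      ≡⟨ cong Γ (trans (merge-++-suc i u v) (cong (_++ i ∷ merge i v) (merge-identity u≤i))) ⟩
    Γ (u ++ i ∷ merge i v)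
      ≡⟨ Γ-unfold-++ u (merge i v)
           (All.++⁺ u≤i (≤-refl ∷ All.map⁺ (All.map (mergeVal-bound ≤-refl) v≤1+i))) ⟩
    node (map Γ (splitOn i u) ++ map Γ (splitOn i (merge i v)))
      ≡⟨ cong (λ ps → node (map Γ (splitOn i u) ++ map Γ ps)) (splitOn-merge-max i∉v v≤1+i) ⟩
    node (map Γ (splitOn i u) ++ map Γ (splitOn (suc i) v)) ∎

-- Dually, cutting at the last i + 1 shows that merging dissolves the last
-- subtree into the root: rule (3).
Γ-merge-max-down : ∀ {i γ} → i ∈ γ → suc i ∈ γ → All (_≤ suc i) γ → Precedes (suc i) i γ →
                   Γ (merge i γ) ≤T Γ γ
Γ-merge-max-down {i} i∈γ 1+i∈γ γ≤1+i 1+i≺i with ∈-∃++-last 1+i∈γ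
... | u , v , refl , 1+i∉v =
  subst₂ _≤T_ (sym unfold-merge) (sym unfold-γ)
    (rule3 (Γ-splitOn-nonempty (suc i) u) (Γ-splitOn-length i∈v) (Γ-valid-all _) (Γ-valid-all _))
  where
  open ≡-Reasoning
  i∉u : i ∉ u
  i∉u = Precedes-before u v 1+i≺i
  i∈v : i ∈ v
  i∈v = [ (λ i∈u → contradiction i∈u i∉u) , id ]′ (∈-++-∷⁻ u i∈γ (<⇒≢ (n<1+n i)))
  u≤1+i : All (_≤ suc i) u
  u≤1+i = All.++⁻ˡ u γ≤1+i
  v≤i : All (_≤ i) v
  v≤i = All-≤-pred (All.tail (All.++⁻ʳ u γ≤1+i)) 1+i∉v
  unfold-γ : Γ (u ++ suc i ∷ v) ≡ node (map Γ (splitOn (suc i) u) ++ [ node (map Γ (splitOn i v)) ])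
  unfold-γ rewrite Γ-unfold-++ u v γ≤1+i | splitOn-∉ 1+i∉v | Γ-unfold i∈v v≤i = refl
  unfold-merge : Γ (merge i (u ++ suc i ∷ v)) ≡ node (map Γ (splitOn (suc i) u) ++ map Γ (splitOn i v))
  unfold-merge = begin
    Γ (merge i (u ++ suc i ∷ v))
      ≡⟨ cong Γ (trans (merge-++-suc i u v) (cong (λ v′ → merge i u ++ i ∷ v′) (merge-identity v≤i))) ⟩
    Γ (merge i u ++ i ∷ v)
      ≡⟨ Γ-unfold-++ (merge i u) v
           (All.++⁺ (All.map⁺ (All.map (mergeVal-bound ≤-refl) u≤1+i)) (≤-refl ∷ v≤i)) ⟩
    node (map Γ (splitOn i (merge i u)) ++ map Γ (splitOn i v))
      ≡⟨ cong (λ ps → node (map Γ ps ++ map Γ (splitOn i v))) (splitOn-merge-max i∉u u≤1+i) ⟩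
    node (map Γ (splitOn (suc i) u) ++ map Γ (splitOn i v)) ∎

merge-strictMonoOn : ∀ {i p} → ¬ (i ∈ p × suc i ∈ p) → StrictMonoOn p (mergeVal i)
merge-strictMonoOn not-both x∈p y∈p x<y = mergeVal-strict x<y λ { (refl , refl) → not-both (x∈p , y∈p) }

Γ-merge-absent : ∀ {i} p → ¬ (i ∈ p × suc i ∈ p) → Γ (merge i p) ≡ Γ p
Γ-merge-absent p not-both = Γ-invariant p (merge-strictMonoOn not-both)

Γ-merge-below-max : ∀ {i R γ} → suc i < R → R ∈ γ → All (_≤ R) γ →
                    Γ (merge i γ) ≡ node (map (Γ ∘ merge i) (splitOn R γ))
Γ-merge-below-max {i} {suc r} {γ} (s≤s i<r) R∈γ γ≤R = begin
  Γ (merge i γ)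
    ≡⟨ Γ-unfold r∈merge merge≤r ⟩
  node (map Γ (splitOn r (merge i γ)))
    ≡⟨ cong (node ∘ map Γ) (splitOn-map (mergeVal i) γ λ _ → mergeVal-≡-above i<r) ⟩
  node (map Γ (map (merge i) (splitOn (suc r) γ)))
    ≡⟨ cong node (List.map-∘ (splitOn (suc r) γ)) ⟨
  node (map (Γ ∘ merge i) (splitOn (suc r) γ)) ∎
  where
  open ≡-Reasoning
  r∈merge : r ∈ merge i γ
  r∈merge = subst (_∈ merge i γ) (mergeVal-suc (<⇒≤ i<r)) (∈-map⁺ (mergeVal i) R∈γ)
  merge≤r : All (_≤ r) (merge i γ)
  merge≤r = All.map⁺ (All.map (mergeVal-bound (<⇒≤ i<r)) γ≤R)

Γ-merge-up : ∀ n {i} γ → length γ ≤ n → i ∈ γ → suc i ∈ γ → Precedes i (suc i) γ →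
             Γ γ ≤T Γ (merge i γ)
Γ-merge-up zero    []      _   ()
Γ-merge-up (suc n) {i} γ len i∈γ 1+i∈γ i≺1+i with m≤n⇒m<n∨m≡n (All.lookup (maxW-upper γ) 1+i∈γ)
... | inj₂ 1+i≡R =
  Γ-merge-max-up i∈γ 1+i∈γ (subst (λ R → All (_≤ R) γ) (sym 1+i≡R) (maxW-upper γ)) i≺1+i
... | inj₁ 1+i<R =
  subst₂ _≤T_ (sym (Γ-unfold R∈γ (maxW-upper γ))) (sym (Γ-merge-below-max 1+i<R R∈γ (maxW-upper γ)))
    (node-map-mono (splitOn-length R∈γ) (All.universal Γ-valid _) (All.universal (Γ-valid ∘ merge i) _)
      (All.zipWith block (splitOn-⊆ (maxW γ) γ , splitOn-shorter R∈γ)))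
  where
  R∈γ : maxW γ ∈ γ
  R∈γ = ∈⇒maxW-∈ i∈γ
  block : ∀ {p} → p ⊆ γ × length p < length γ → Γ p ≤T Γ (merge i p)
  block {p} (p⊆γ , p<γ) with i ∈? p ×-dec suc i ∈? p
  ... | yes (i∈p , 1+i∈p) =
    Γ-merge-up n p (≤-pred (≤-trans p<γ len)) i∈p 1+i∈p (Precedes-⊆ p⊆γ i≺1+i)
  ... | no not-both       = ≡⇒≤T (sym (Γ-merge-absent p not-both))

Γ-merge-down : ∀ n {i} γ → length γ ≤ n → i ∈ γ → suc i ∈ γ → Precedes (suc i) i γ →
               Γ (merge i γ) ≤T Γ γ
Γ-merge-down zero    []      _   ()
Γ-merge-down (suc n) {i} γ len i∈γ 1+i∈γ 1+i≺i with m≤n⇒m<n∨m≡n (All.lookup (maxW-upper γ) 1+i∈γ)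
... | inj₂ 1+i≡R =
  Γ-merge-max-down i∈γ 1+i∈γ (subst (λ R → All (_≤ R) γ) (sym 1+i≡R) (maxW-upper γ)) 1+i≺i
... | inj₁ 1+i<R =
  subst₂ _≤T_ (sym (Γ-merge-below-max 1+i<R R∈γ (maxW-upper γ))) (sym (Γ-unfold R∈γ (maxW-upper γ)))
    (node-map-mono (splitOn-length R∈γ) (All.universal (Γ-valid ∘ merge i) _) (All.universal Γ-valid _)
      (All.zipWith block (splitOn-⊆ (maxW γ) γ , splitOn-shorter R∈γ)))
  where
  R∈γ : maxW γ ∈ γ
  R∈γ = ∈⇒maxW-∈ i∈γ
  block : ∀ {p} → p ⊆ γ × length p < length γ → Γ (merge i p) ≤T Γ p
  block {p} (p⊆γ , p<γ) with i ∈? p ×-dec suc i ∈? p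
  ... | yes (i∈p , 1+i∈p) =
    Γ-merge-down n p (≤-pred (≤-trans p<γ len)) i∈p 1+i∈p (Precedes-⊆ p⊆γ 1+i≺i)
  ... | no not-both       = ≡⇒≤T (Γ-merge-absent p not-both)

Γ-mono-step : ∀ {γ δ} → BStep γ δ → Γ γ ≤T Γ δ
Γ-mono-step {γ} (up i (_ , onto) 1≤i i<r before) =
  Γ-merge-up _ γ ≤-refl (onto i 1≤i (<⇒≤ i<r)) (onto (suc i) (s≤s z≤n) i<r)
    (Before⇒Precedes γ (<⇒≢ (n<1+n i)) before)
Γ-mono-step {δ = δ} (down i (_ , onto) 1≤i i<r before) =
  Γ-merge-down _ δ ≤-refl (onto i 1≤i (<⇒≤ i<r)) (onto (suc i) (s≤s z≤n) i<r)
    (Before⇒Precedes δ (>⇒≢ (n<1+n i)) before)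

Γ-mono : ∀ {γ δ} → γ ≤P δ → Γ γ ≤T Γ δ
Γ-mono ε           = ≤T-refl
Γ-mono (s ◅ steps) = ≤T-trans (Γ-mono-step s) (Γ-mono steps)

Spans : ℕ → ℕ → List ℕ → Set
Spans lo n w = All (λ x → lo < x × x ≤ lo + n) w × (∀ {j} → lo < j → j ≤ lo + n → j ∈ w)

shift : ℕ → List ℕ → List ℕ
shift c = map (c +_)

shift-strictMonoOn : ∀ c w → StrictMonoOn w (c +_)
shift-strictMonoOn c w _ _ = +-monoʳ-< c

Spans-[] : ∀ lo → Spans lo 0 []
Spans-[] lo = [] , λ lo<j j≤lo+0 → contradiction (subst (_ ≤_) (+-identityʳ lo) j≤lo+0) (<⇒≱ lo<j)

Spans-shift : ∀ c {lo n w} → Spans lo n w → Spans (c + lo) n (shift c w)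
Spans-shift c {lo} {n} {w} (bounds , covers) = All.map⁺ (All.map shifted bounds) , shifted-covers
  where
  shifted : ∀ {x} → lo < x × x ≤ lo + n → c + lo < c + x × c + x ≤ c + lo + n
  shifted (lo<x , x≤) = +-monoʳ-< c lo<x , ≤-trans (+-monoʳ-≤ c x≤) (≤-reflexive (sym (+-assoc c lo n)))
  shifted-covers : ∀ {j} → c + lo < j → j ≤ c + lo + n → j ∈ shift c w
  shifted-covers c+lo<j j≤ with m≤n⇒∃[o]m+o≡n (≤-trans (m≤m+n c lo) (<⇒≤ c+lo<j))
  ... | k , refl = ∈-map⁺ (c +_) (covers (+-cancelˡ-< c lo k c+lo<j)
                                         (+-cancelˡ-≤ c k (lo + n) (≤-trans j≤ (≤-reflexive (+-assoc c lo n)))))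

Spans-++ : ∀ {lo m n u v} → Spans lo m u → Spans (lo + m) n v → Spans lo (m + n) (u ++ v)
Spans-++ {lo} {m} {n} {u} {v} (u-bounds , u-covers) (v-bounds , v-covers) =
  All.++⁺ (All.map (λ (lo<x , x≤) → lo<x , ≤-trans x≤ (≤-trans (m≤m+n (lo + m) n) assoc)) u-bounds)
          (All.map (λ (lo+m<x , x≤) → ≤-<-trans (m≤m+n lo m) lo+m<x , ≤-trans x≤ assoc) v-bounds) ,
  covers
  where
  assoc : lo + m + n ≤ lo + (m + n)
  assoc = ≤-reflexive (+-assoc lo m n)
  covers : ∀ {j} → lo < j → j ≤ lo + (m + n) → j ∈ u ++ v
  covers {j} lo<j j≤ with j ≤? lo + m
  ... | yes j≤lo+m = ∈-++⁺ˡ (u-covers lo<j j≤lo+m)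
  ... | no  j≰lo+m = ∈-++⁺ʳ u (v-covers (≰⇒> j≰lo+m) (≤-trans j≤ (≤-reflexive (sym (+-assoc lo m n)))))

Spans-intercalate : ∀ {lo n} ps → 2 ≤ length ps → Spans lo n (concat ps) →
                    Spans lo (suc n) (intercalate [ lo + suc n ] ps)
Spans-intercalate {lo} {n} ps len (bounds , covers) =
  intercalate-All ps ((m<m+n lo z<s , ≤-refl) ∷ [])
    (All.map (λ (lo<x , x≤) → lo<x , ≤-trans x≤ lo+n≤sep) bounds) ,
  covers′
  where
  lo+n≤sep : lo + n ≤ lo + suc n
  lo+n≤sep = +-monoʳ-≤ lo (n≤1+n n)
  covers′ : ∀ {j} → lo < j → j ≤ lo + suc n → j ∈ intercalate [ lo + suc n ] ps
  covers′ lo<j j≤sep with m≤n⇒m<n∨m≡n j≤sep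
  ... | inj₂ refl  = ∈-intercalate-sep ps (here refl) len
  ... | inj₁ j<sep = ∈-intercalate⁺ ps (covers lo<j (≤-pred (≤-trans j<sep (≤-reflexive (+-suc lo n)))))

Spans-maxW : ∀ {lo n w} → Spans lo (suc n) w → maxW w ≡ lo + suc n
Spans-maxW {lo} (bounds , covers) = maxW-unique (covers (m<m+n lo z<s) ≤-refl) (All.map proj₂ bounds)

Spans⇒Packed : ∀ {n w} → Spans 0 n w → Packed w
Spans⇒Packed {w = w} (bounds , covers) =
  All.map proj₁ bounds , λ j 1≤j j≤max → covers 1≤j (≤-trans j≤max (maxW-least w (All.map proj₂ bounds)))

Packed⇒Spans : ∀ {w} → Packed w → Spans 0 (maxW w) w
Packed⇒Spans {w} (positive , onto) = All.zip (positive , maxW-upper w) , onto _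

Spans-map-involution : ∀ {f : ℕ → ℕ} {lo n w} → (∀ x → f (f x) ≡ x) →
                       (∀ {x} → lo < x × x ≤ lo + n → lo < f x × f x ≤ lo + n) →
                       Spans lo n w → Spans lo n (map f w)
Spans-map-involution {f} {w = w} f∘f≡id f-bounds (bounds , covers) =
  All.map⁺ (All.map f-bounds bounds) ,
  λ {j} lo<j j≤ → let fj-bounds = f-bounds (lo<j , j≤) in
    subst (_∈ map f w) (f∘f≡id j) (∈-map⁺ f (covers (proj₁ fj-bounds) (proj₂ fj-bounds)))

-- A section of Γ

mutual
  nodeCount : Tree → ℕ
  nodeCount leaf      = 0
  nodeCount (node ts) = suc (nodeCountL ts)

  nodeCountL : List Tree → ℕ
  nodeCountL []       = 0
  nodeCountL (t ∷ ts) = nodeCount t + nodeCountL ts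

-- The values of toWord t are the internal vertices of t, numbered in
-- postorder; the value of a vertex separates the words of its subtrees.
mutual
  toWord : Tree → List ℕ
  toWord leaf      = []
  toWord (node ts) = intercalate [ suc (nodeCountL ts) ] (childWords 0 ts)

  childWords : ℕ → List Tree → List (List ℕ)
  childWords c []       = []
  childWords c (t ∷ ts) = shift c (toWord t) ∷ childWords (c + nodeCount t) ts

length-childWords : ∀ c ts → length (childWords c ts) ≡ length ts
length-childWords c []       = refl
length-childWords c (t ∷ ts) = cong suc (length-childWords (c + nodeCount t) ts)

mutual
  toWord-spans : ∀ {t} → Valid t → Spans 0 (nodeCount t) (toWord t)
  toWord-spans leaf                  = Spans-[] 0
  toWord-spans (node {ts} len ts-ok) =
    Spans-intercalate (childWords 0 ts) (subst (2 ≤_) (sym (length-childWords 0 ts)) len)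
                      (childWords-spans 0 ts-ok)

  childWords-spans : ∀ c {ts} → All Valid ts → Spans c (nodeCountL ts) (concat (childWords c ts))
  childWords-spans c []                       = Spans-[] c
  childWords-spans c {t ∷ ts} (t-ok ∷ ts-ok) =
    Spans-++ (subst (λ lo → Spans lo (nodeCount t) (shift c (toWord t))) (+-identityʳ c)
                    (Spans-shift c (toWord-spans t-ok)))
             (childWords-spans (c + nodeCount t) ts-ok)

childWords-bounds : ∀ c {ts} → All Valid ts → All (All (λ x → c < x × x ≤ c + nodeCountL ts)) (childWords c ts)
childWords-bounds c ts-ok = All.concat⁻ (proj₁ (childWords-spans c ts-ok))

toWord-packed : ∀ {t} → Valid t → Packed (toWord t)
toWord-packed t-ok = Spans⇒Packed (toWord-spans t-ok)

toWord-maxW : ∀ {t} → Valid t → maxW (toWord t) ≡ nodeCount t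
toWord-maxW leaf            = refl
toWord-maxW t-ok@(node _ _) = Spans-maxW (toWord-spans t-ok)

mutual
  toWord-length : ∀ {t} → Valid t → suc (length (toWord t)) ≡ leaves t
  toWord-length leaf                     = refl
  toWord-length (node {t ∷ ts} _ ts-ok) =
    trans (length-intercalate (suc (nodeCountL (t ∷ ts))) (shift 0 (toWord t)) (childWords (0 + nodeCount t) ts))
          (childWords-length 0 ts-ok)

  childWords-length : ∀ c {ts} → All Valid ts → sum (map (λ p → suc (length p)) (childWords c ts)) ≡ leavesL ts
  childWords-length c []                       = refl
  childWords-length c {t ∷ ts} (t-ok ∷ ts-ok) =
    cong₂ _+_ (trans (cong suc (List.length-map (c +_) (toWord t))) (toWord-length t-ok))
              (childWords-length (c + nodeCount t) ts-ok)

toWord-∈P : ∀ {n t} → InT n t → InP n (toWord t)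
toWord-∈P (t-ok , leaves≡) = suc-injective (trans (toWord-length t-ok) leaves≡) , toWord-packed t-ok

mutual
  Γ-toWord : ∀ {t} → Valid t → Γ (toWord t) ≡ t
  Γ-toWord leaf = refl
  Γ-toWord t-ok@(node {t ∷ ts} len ts-ok) = begin
    Γ (intercalate [ M ] ps)
      ≡⟨ Γ-unfold (∈-intercalate-sep ps (here refl) (subst (2 ≤_) (sym (length-childWords 0 (t ∷ ts))) len))
                  (All.map proj₂ (proj₁ (toWord-spans t-ok))) ⟩
    node (map Γ (splitOn M (intercalate [ M ] ps)))
      ≡⟨ cong (node ∘ map Γ) (splitOn-intercalate (shift 0 (toWord t)) (childWords (0 + nodeCount t) ts) M∉ps) ⟩
    node (map Γ ps)
      ≡⟨ cong node (Γ-childWords 0 ts-ok) ⟩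
    node (t ∷ ts) ∎
    where
    open ≡-Reasoning
    M : ℕ
    M = suc (nodeCountL (t ∷ ts))
    ps : List (List ℕ)
    ps = childWords 0 (t ∷ ts)
    M∉ps : All (M ∉_) ps
    M∉ps = All.map (λ p-bounds → All-≢⇒∉ (All.map (λ (_ , x≤) → <⇒≢ (s≤s x≤)) p-bounds))
                   (childWords-bounds 0 ts-ok)

  Γ-childWords : ∀ c {ts} → All Valid ts → map Γ (childWords c ts) ≡ ts
  Γ-childWords c []                       = refl
  Γ-childWords c {t ∷ ts} (t-ok ∷ ts-ok) =
    cong₂ _∷_ (trans (Γ-invariant (toWord t) (shift-strictMonoOn c (toWord t))) (Γ-toWord t-ok))
              (Γ-childWords (c + nodeCount t) ts-ok)

nodeCountL-++ : ∀ ts us → nodeCountL (ts ++ us) ≡ nodeCountL ts + nodeCountL us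
nodeCountL-++ []       us = refl
nodeCountL-++ (t ∷ ts) us rewrite nodeCountL-++ ts us = sym (+-assoc (nodeCount t) (nodeCountL ts) (nodeCountL us))

childWords-++ : ∀ c ts us → childWords c (ts ++ us) ≡ childWords c ts ++ childWords (c + nodeCountL ts) us
childWords-++ c []       us rewrite +-identityʳ c = refl
childWords-++ c (t ∷ ts) us rewrite childWords-++ (c + nodeCount t) ts us | +-assoc c (nodeCount t) (nodeCountL ts) =
  refl

toWord-++ : ∀ ts us → toWord (node (ts ++ us)) ≡
            intercalate [ suc (nodeCountL ts + nodeCountL us) ] (childWords 0 ts ++ childWords (nodeCountL ts) us)
toWord-++ ts us = cong₂ (λ n ps → intercalate [ suc n ] ps) (nodeCountL-++ ts us) (childWords-++ 0 ts us)

shift-shift : ∀ c d w → shift c (shift d w) ≡ shift (c + d) w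
shift-shift c d w = trans (sym (List.map-∘ w)) (List.map-cong (λ x → sym (+-assoc c d x)) w)

childWords-shift : ∀ c d ts → map (shift c) (childWords d ts) ≡ childWords (c + d) ts
childWords-shift c d []       = refl
childWords-shift c d (t ∷ ts)
  rewrite shift-shift c d (toWord t) | childWords-shift c (d + nodeCount t) ts | +-assoc c d (nodeCount t) = refl

childWords-pred : ∀ c ts → map (map pred) (childWords (suc c) ts) ≡ childWords c ts
childWords-pred c ts = begin
  map (map pred) (childWords (1 + c) ts)           ≡⟨ cong (map (map pred)) (childWords-shift 1 c ts) ⟨
  map (map pred) (map (shift 1) (childWords c ts)) ≡⟨ List.map-∘ (childWords c ts) ⟨
  map (map pred ∘ shift 1) (childWords c ts)
    ≡⟨ List.map-cong (λ w → trans (sym (List.map-∘ w)) (List.map-id w)) _ ⟩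
  map id (childWords c ts)                         ≡⟨ List.map-id (childWords c ts) ⟩
  childWords c ts                                  ∎
  where open ≡-Reasoning

shift-toWord-node : ∀ c us → shift c (toWord (node us)) ≡ intercalate [ c + suc (nodeCountL us) ] (childWords c us)
shift-toWord-node c us = begin
  shift c (intercalate [ suc U ] (childWords 0 us))
    ≡⟨ map-intercalate (c +_) [ suc U ] (childWords 0 us) ⟩
  intercalate [ c + suc U ] (map (shift c) (childWords 0 us))
    ≡⟨ cong (intercalate [ c + suc U ]) (childWords-shift c 0 us) ⟩
  intercalate [ c + suc U ] (childWords (c + 0) us)
    ≡⟨ cong (intercalate [ c + suc U ] ∘ flip childWords us) (+-identityʳ c) ⟩
  intercalate [ c + suc U ] (childWords c us) ∎
  where
  open ≡-Reasoning
  U : ℕ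
  U = nodeCountL us

-- The section is monotone

-- A single down step merges the root of the last subtree into the root.
module Rule3 {t ts′ u us′} (ts-ok : All Valid (t ∷ ts′)) (len-us : 2 ≤ length (u ∷ us′))
             (us-ok : All Valid (u ∷ us′)) where

  private
    ts us : List Tree
    ts = t ∷ ts′
    us = u ∷ us′
    A i : ℕ
    A = nodeCountL ts
    i = suc (A + nodeCountL us)
    P Q : List (List ℕ)
    P = childWords 0 ts
    Q = childWords A us
    X : List ℕ
    X = intercalate [ i ] Q

  nested-valid : Valid (node (ts ++ [ node us ]))
  nested-valid = node (subst (2 ≤_) (sym (List.length-++ ts)) (s≤s (m≤n+m 1 (length ts′))))
                      (All.++⁺ ts-ok (node len-us us-ok ∷ []))

  nodeCount-nested : nodeCountL (ts ++ [ node us ]) ≡ i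
  nodeCount-nested = trans (nodeCountL-++ ts [ node us ]) (trans (cong (A +_) (+-identityʳ _)) (+-suc A _))

  toWord-nested : toWord (node (ts ++ [ node us ])) ≡ intercalate [ suc i ] (P ++ [ X ])
  toWord-nested = cong₂ (λ n ps → intercalate [ suc n ] ps) nodeCount-nested
    (trans (childWords-++ 0 ts [ node us ])
           (cong (λ w → P ++ [ w ]) (trans (shift-toWord-node A us) (cong (λ n → intercalate [ n ] Q) (+-suc A _)))))

  private
    P≤A : All (All (_≤ A)) P
    P≤A = All.map (All.map proj₂) (childWords-bounds 0 ts-ok)
    P≤i : All (All (_≤ i)) P
    P≤i = All.map (All.map (λ x≤A → ≤-trans x≤A (m≤n⇒m≤1+n (m≤m+n A _)))) P≤A
    X≤i : All (_≤ i) X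
    X≤i = intercalate-All Q (≤-refl ∷ [])
            (All.concat⁺ (All.map (All.map (λ (_ , x≤) → m≤n⇒m≤1+n x≤)) (childWords-bounds A us-ok)))

  merge-nested : merge i (intercalate [ suc i ] (P ++ [ X ])) ≡ toWord (node (ts ++ us))
  merge-nested = begin
    merge i (intercalate [ suc i ] (P ++ [ X ]))
      ≡⟨ map-intercalate (mergeVal i) [ suc i ] (P ++ [ X ]) ⟩
    intercalate [ mergeVal i (suc i) ] (map (merge i) (P ++ [ X ]))
      ≡⟨ cong₂ (λ s ps → intercalate [ s ] ps) (mergeVal-1+i i)
               (List.map-id-local (All.++⁺ (All.map merge-identity P≤i) (merge-identity X≤i ∷ []))) ⟩
    intercalate [ i ] (P ++ [ X ])
      ≡⟨ intercalate-nested [ i ] P _ _ ⟩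
    intercalate [ i ] (P ++ Q)
      ≡⟨ toWord-++ ts us ⟨
    toWord (node (ts ++ us)) ∎
    where open ≡-Reasoning

  root-after-child : Precedes (suc i) i (intercalate [ suc i ] (P ++ [ X ]))
  root-after-child =
    subst (Precedes (suc i) i)
      (sym (intercalate-++ [ suc i ] (shift 0 (toWord t)) (childWords (0 + nodeCount t) ts′) X []))
      (Precedes-++ˡ (intercalate [ suc i ] P)
        (All-≢⇒∉ (intercalate-All P (1+n≢n ∷ [])
          (All.concat⁺ (All.map (All.map λ x≤A → <⇒≢ (s≤s (≤-trans x≤A (m≤m+n A _)))) P≤A))))
        (step 1+n≢n (done (All-≢⇒∉ (All.map (λ x≤i → <⇒≢ (s≤s x≤i)) X≤i)))))

  down-step : BStep (toWord (node (ts ++ us))) (toWord (node (ts ++ [ node us ])))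
  down-step = subst (λ w → BStep w (toWord (node (ts ++ [ node us ]))))
                    (trans (cong (merge i) toWord-nested) merge-nested)
    (down i (toWord-packed nested-valid) (s≤s z≤n)
      (≤-reflexive (sym (trans (toWord-maxW nested-valid) (cong suc nodeCount-nested))))
      (Precedes⇒Before _ (subst (Precedes (suc i) i) (sym toWord-nested) root-after-child)))

toWord-rule3 : ∀ {ts us} → 1 ≤ length ts → 2 ≤ length us → All Valid ts → All Valid us →
               toWord (node (ts ++ us)) ≤P toWord (node (ts ++ [ node us ]))
toWord-rule3 {[]}    ()
toWord-rule3 {_ ∷ _} {[]}    _ ()
toWord-rule3 {_ ∷ _} {_ ∷ _} _ len-us ts-ok us-ok = Rule3.down-step ts-ok len-us us-ok ◅ ε

module InContext {ls rs : List Tree} (ls-ok : All Valid ls) (rs-ok : All Valid rs)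
                 (len : 1 ≤ length ls + length rs) where

  private
    A B : ℕ
    A = nodeCountL ls
    B = nodeCountL rs
    P : List (List ℕ)
    P = childWords 0 ls

  -- The word of node (ls ++ t ∷ rs) as a function of the word u of t,
  -- where t has maxW u internal vertices.
  inContext : List ℕ → List ℕ
  inContext u = intercalate [ suc (A + (maxW u + B)) ] (P ++ shift A u ∷ childWords (A + maxW u) rs)

  toWord-inContext : ∀ {t} → Valid t → toWord (node (ls ++ t ∷ rs)) ≡ inContext (toWord t)
  toWord-inContext {t} t-ok rewrite nodeCountL-++ ls (t ∷ rs) | childWords-++ 0 ls (t ∷ rs) | toWord-maxW t-ok = refl

  inContext-spans : ∀ {u} → Packed u → Spans 0 (suc (A + (maxW u + B))) (inContext u)
  inContext-spans {u} u-ok = Spans-intercalate parts two-parts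
    (subst (Spans 0 _) (List.concat-++ P (shift A u ∷ childWords (A + maxW u) rs))
      (Spans-++ (childWords-spans 0 ls-ok)
        (Spans-++ (subst (λ lo → Spans lo (maxW u) (shift A u)) (+-identityʳ A) (Spans-shift A (Packed⇒Spans u-ok)))
                  (childWords-spans (A + maxW u) rs-ok))))
    where
    parts : List (List ℕ)
    parts = P ++ shift A u ∷ childWords (A + maxW u) rs
    two-parts : 2 ≤ length parts
    two-parts rewrite List.length-++ P {shift A u ∷ childWords (A + maxW u) rs}
                    | length-childWords 0 ls | length-childWords (A + maxW u) rs
                    | +-suc (length ls) (length rs) = s≤s len

  inContext-index< : ∀ {i u} → Packed u → i < maxW u → A + i < maxW (inContext u)
  inContext-index< u-ok i<m =
    ≤-trans (s≤s (+-monoʳ-≤ A (≤-trans (<⇒≤ i<m) (m≤m+n _ B))))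
            (≤-reflexive (sym (Spans-maxW (inContext-spans u-ok))))

  inContext-merge : ∀ {i u} → i < maxW u → inContext (merge i u) ≡ merge (A + i) (inContext u)
  inContext-merge {i} {u} i<max with maxW u in max≡
  ... | suc m rewrite merge-maxW u max≡ i<max = sym (begin
    merge (A + i) (intercalate [ suc (A + (suc m + B)) ] (P ++ shift A u ∷ Pr))
      ≡⟨ map-intercalate (mergeVal (A + i)) _ (P ++ shift A u ∷ Pr) ⟩
    intercalate [ mergeVal (A + i) (suc (A + (suc m + B))) ] (map (merge (A + i)) (P ++ shift A u ∷ Pr))
      ≡⟨ cong₂ (λ s ps → intercalate [ s ] ps) separator (List.map-++ (merge (A + i)) P (shift A u ∷ Pr)) ⟩
    intercalate [ suc (A + (m + B)) ] (map (merge (A + i)) P ++ merge (A + i) (shift A u) ∷ map (merge (A + i)) Pr)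
      ≡⟨ cong₂ (λ ps qs → intercalate [ suc (A + (m + B)) ] (ps ++ qs)) left (cong₂ _∷_ middle right) ⟩
    intercalate [ suc (A + (m + B)) ] (P ++ shift A (merge i u) ∷ childWords (A + m) rs) ∎)
    where
    open ≡-Reasoning
    Pr : List (List ℕ)
    Pr = childWords (A + suc m) rs
    i≤m : i ≤ m
    i≤m = ≤-pred i<max
    separator : mergeVal (A + i) (suc (A + (suc m + B))) ≡ suc (A + (m + B))
    separator = trans (mergeVal-suc (+-monoʳ-≤ A (≤-trans i≤m (≤-trans (m≤m+n m B) (n≤1+n _)))))
                      (+-suc A (m + B))
    left : map (merge (A + i)) P ≡ P
    left = List.map-id-local (All.map
      (λ p-bounds → merge-identity (All.map (λ (_ , x≤A) → ≤-trans x≤A (m≤m+n A i)) p-bounds))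
      (childWords-bounds 0 ls-ok))
    middle : merge (A + i) (shift A u) ≡ shift A (merge i u)
    middle = trans (sym (List.map-∘ u)) (trans (List.map-cong (mergeVal-shift A i) u) (List.map-∘ u))
    right : map (merge (A + i)) Pr ≡ childWords (A + m) rs
    right = begin
      map (merge (A + i)) Pr
        ≡⟨ List.map-cong-local (All.map (λ p-bounds → List.map-cong-local (All.map
             (λ (A+1+m<x , _) → mergeVal-pred (≤-<-trans (+-monoʳ-≤ A (m≤n⇒m≤1+n i≤m)) A+1+m<x)) p-bounds))
             (childWords-bounds (A + suc m) rs-ok)) ⟩
      map (map pred) Pr
        ≡⟨ cong (λ c → map (map pred) (childWords c rs)) (+-suc A m) ⟩
      map (map pred) (childWords (suc (A + m)) rs)
        ≡⟨ childWords-pred (A + m) rs ⟩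
      childWords (A + m) rs ∎

  inContext-precedes : ∀ {a b u} → a ≤ maxW u → 1 ≤ b → b ≤ maxW u → Precedes a b u →
                       Precedes (A + a) (A + b) (inContext u)
  inContext-precedes {a} {b} {u} a≤m 1≤b b≤m a≺b =
    Precedes-intercalate [ M ] P (shift A u) (childWords (A + m) rs) (below-M a≤m) (below-M b≤m)
      (All-≢⇒∉ (All.concat⁺ (All.map (All.map (λ (_ , x≤A) → <⇒≢ (≤-<-trans x≤A (m<m+n A 1≤b))))
                                     (childWords-bounds 0 ls-ok))))
      (All-≢⇒∉ (All.concat⁺ (All.map (All.map (λ (A+m<x , _) → >⇒≢ (≤-<-trans (+-monoʳ-≤ A a≤m) A+m<x)))
                                     (childWords-bounds (A + m) rs-ok))))
      (Precedes-map (+-cancelˡ-≡ A _ _) u a≺b)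
    where
    m M : ℕ
    m = maxW u
    M = suc (A + (m + B))
    below-M : ∀ {x} → x ≤ m → A + x ∉ [ M ]
    below-M x≤m (here A+x≡M) = <⇒≢ (s≤s (+-monoʳ-≤ A (≤-trans x≤m (m≤m+n m B)))) A+x≡M

  inContext-step : ∀ {u v} → BStep u v → BStep (inContext u) (inContext v)
  inContext-step (up {u} i u-ok 1≤i i<m before) =
    subst (BStep (inContext u)) (sym (inContext-merge i<m))
      (up (A + i) (Spans⇒Packed (inContext-spans u-ok)) (≤-trans 1≤i (m≤n+m i A)) (inContext-index< u-ok i<m)
        (Precedes⇒Before _ (subst (λ b → Precedes (A + i) b (inContext u)) (+-suc A i)
          (inContext-precedes (<⇒≤ i<m) (s≤s z≤n) i<m (Before⇒Precedes u (<⇒≢ (n<1+n i)) before)))))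
  inContext-step (down {u} i u-ok 1≤i i<m before) =
    subst (λ w → BStep w (inContext u)) (sym (inContext-merge i<m))
      (down (A + i) (Spans⇒Packed (inContext-spans u-ok)) (≤-trans 1≤i (m≤n+m i A)) (inContext-index< u-ok i<m)
        (Precedes⇒Before _ (subst (λ a → Precedes a (A + i) (inContext u)) (+-suc A i)
          (inContext-precedes i<m 1≤i (<⇒≤ i<m) (Before⇒Precedes u (>⇒≢ (n<1+n i)) before)))))

toWord-rule1 : ∀ {ls rs t w} → 1 ≤ length ls + length rs → All Valid ls → All Valid rs → Valid t → Valid w →
               toWord t ≤P toWord w → toWord (node (ls ++ t ∷ rs)) ≤P toWord (node (ls ++ w ∷ rs))
toWord-rule1 len ls-ok rs-ok t-ok w-ok t≤w =
  subst₂ _≤P_ (sym (toWord-inContext t-ok)) (sym (toWord-inContext w-ok)) (Star.gmap inContext inContext-step t≤w)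
  where open InContext ls-ok rs-ok len

transpose : ℕ → ℕ → ℕ
transpose c x = if x ≡ᵇ c then suc c else if x ≡ᵇ suc c then c else x

transpose-c : ∀ c → transpose c c ≡ suc c
transpose-c c with c ≡ᵇ c | ≡ᵇ-reflects-≡ c c
... | true  | _       = refl
... | false | ofⁿ c≢c = contradiction refl c≢c

transpose-1+c : ∀ c → transpose c (suc c) ≡ c
transpose-1+c c
  with suc c ≡ᵇ c | ≡ᵇ-reflects-≡ (suc c) c | suc c ≡ᵇ suc c | ≡ᵇ-reflects-≡ (suc c) (suc c)
... | true  | ofʸ 1+c≡c | _     | _             = contradiction 1+c≡c 1+n≢n
... | false | _         | true  | _             = refl
... | false | _         | false | ofⁿ 1+c≢1+c = contradiction refl 1+c≢1+c

transpose-other : ∀ {c x} → x ≢ c → x ≢ suc c → transpose c x ≡ x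
transpose-other {c} {x} x≢c x≢1+c
  with x ≡ᵇ c | ≡ᵇ-reflects-≡ x c | x ≡ᵇ suc c | ≡ᵇ-reflects-≡ x (suc c)
... | true  | ofʸ x≡c | _     | _           = contradiction x≡c x≢c
... | false | _       | true  | ofʸ x≡1+c = contradiction x≡1+c x≢1+c
... | false | _       | false | _           = refl

data TransposeView (c : ℕ) : ℕ → Set where
  first  : TransposeView c c
  second : TransposeView c (suc c)
  other  : ∀ {x} → x ≢ c → x ≢ suc c → TransposeView c x

transposeView : ∀ c x → TransposeView c x
transposeView c x with x ≟ c | x ≟ suc c
... | yes refl | _          = first
... | no _     | yes refl   = second
... | no x≢c   | no x≢1+c = other x≢c x≢1+c

transpose-involutive : ∀ c x → transpose c (transpose c x) ≡ x
transpose-involutive c x with transposeView c x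
... | first  rewrite transpose-c c   = transpose-1+c c
... | second rewrite transpose-1+c c = transpose-c c
... | other x≢c x≢1+c rewrite transpose-other x≢c x≢1+c = transpose-other x≢c x≢1+c

transpose-injective : ∀ c {x y} → transpose c x ≡ transpose c y → x ≡ y
transpose-injective c {x} {y} eq =
  trans (sym (transpose-involutive c x)) (trans (cong (transpose c) eq) (transpose-involutive c y))

mergeVal-transpose : ∀ c x → mergeVal c (transpose c x) ≡ mergeVal c x
mergeVal-transpose c x with transposeView c x
... | first  rewrite transpose-c c   = trans (mergeVal-1+i c) (sym (mergeVal-≤ ≤-refl))
... | second rewrite transpose-1+c c = trans (mergeVal-≤ ≤-refl) (sym (mergeVal-1+i c))
... | other x≢c x≢1+c rewrite transpose-other x≢c x≢1+c = refl

Spans-transpose : ∀ {c n w} → 1 ≤ c → suc c ≤ n → Spans 0 n w → Spans 0 n (map (transpose c) w)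
Spans-transpose {c} {n} 1≤c 1+c≤n = Spans-map-involution (transpose-involutive c) bounds
  where
  bounds : ∀ {x} → 0 < x × x ≤ n → 0 < transpose c x × transpose c x ≤ n
  bounds {x} x-bounds with transposeView c x
  ... | first  rewrite transpose-c c   = s≤s z≤n , 1+c≤n
  ... | second rewrite transpose-1+c c = 1≤c , ≤-trans (n≤1+n c) 1+c≤n
  ... | other x≢c x≢1+c rewrite transpose-other x≢c x≢1+c = x-bounds

-- An up step merging c and c + 1 followed by a down step splitting them in
-- the other order.
≤P-transpose : ∀ {c n w} → Spans 0 n w → 1 ≤ c → suc c ≤ n → Precedes c (suc c) w →
               w ≤P map (transpose c) w
≤P-transpose {c} {suc n} {w} w-spans 1≤c 1+c≤n c≺1+c =
  up c (Spans⇒Packed w-spans) 1≤c (≤-trans 1+c≤n (≤-reflexive (sym (Spans-maxW w-spans))))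
       (Precedes⇒Before w c≺1+c)
  ◅ subst (λ v → BStep v w′) (trans (sym (List.map-∘ w)) (List.map-cong (mergeVal-transpose c) w))
      (down c (Spans⇒Packed w′-spans) 1≤c (≤-trans 1+c≤n (≤-reflexive (sym (Spans-maxW w′-spans))))
        (Precedes⇒Before w′ (subst₂ (λ a b → Precedes a b w′) (transpose-c c) (transpose-1+c c)
          (Precedes-map (transpose-injective c) w c≺1+c))))
  ◅ ε
  where
  w′ : List ℕ
  w′ = map (transpose c) w
  w′-spans : Spans 0 (suc n) w′
  w′-spans = Spans-transpose 1≤c 1+c≤n w-spans

rotate : ℕ → ℕ → ℕ → ℕ
rotate c zero    = id
rotate c (suc k) = rotate (suc c) k ∘ transpose c

rotate-below : ∀ {c x} k → x < c → rotate c k x ≡ x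
rotate-below zero        x<c = refl
rotate-below {c} (suc k) x<c rewrite transpose-other (<⇒≢ x<c) (<⇒≢ (m<n⇒m<1+n x<c)) =
  rotate-below k (m<n⇒m<1+n x<c)

rotate-start : ∀ c k → rotate c k c ≡ c + k
rotate-start c zero    = sym (+-identityʳ c)
rotate-start c (suc k) rewrite transpose-c c = trans (rotate-start (suc c) k) (sym (+-suc c k))

rotate-inside : ∀ {c x} k → c < x → x ≤ c + k → rotate c k x ≡ pred x
rotate-inside {c} {x} zero    c<x x≤c+0 = contradiction (subst (x ≤_) (+-identityʳ c) x≤c+0) (<⇒≱ c<x)
rotate-inside {c} {x} (suc k) c<x x≤    with transposeView c x
... | first  = contradiction c<x (<-irrefl refl)
... | second rewrite transpose-1+c c = rotate-below k (n<1+n c)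
... | other x≢c x≢1+c rewrite transpose-other x≢c x≢1+c =
  rotate-inside k (≤∧≢⇒< c<x (x≢1+c ∘ sym)) (≤-trans x≤ (≤-reflexive (+-suc c k)))

rotate-above : ∀ {c x} k → c + k < x → rotate c k x ≡ x
rotate-above {c} {x} zero    _     = refl
rotate-above {c} {x} (suc k) c+k<x with ≤-<-trans (≤-reflexive (sym (+-suc c k))) c+k<x
... | 1+c+k<x rewrite transpose-other (>⇒≢ (≤-<-trans (m≤m+n c (suc k)) c+k<x))
                                      (>⇒≢ (≤-<-trans (m≤m+n (suc c) k) 1+c+k<x)) = rotate-above k 1+c+k<x

Spans-rotate : ∀ {c n w} k → 1 ≤ c → c + k ≤ n → Spans 0 n w → Spans 0 n (map (rotate c k) w)
Spans-rotate {w = w} zero    _   _     w-spans = subst (Spans 0 _) (sym (List.map-id w)) w-spans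
Spans-rotate {c} {w = w} (suc k) 1≤c c+k≤n w-spans =
  subst (Spans 0 _) (sym (List.map-∘ w))
    (Spans-rotate k (s≤s z≤n) (≤-trans (≤-reflexive (sym (+-suc c k))) c+k≤n)
      (Spans-transpose 1≤c (≤-trans (s≤s (m≤m+n c k)) (≤-trans (≤-reflexive (sym (+-suc c k))) c+k≤n))
                       w-spans))

≤P-rotate : ∀ {c n} k u v → Spans 0 n (u ++ v) → 1 ≤ c → c + k ≤ n → c ∉ v →
            (∀ {j} → c < j → j ≤ c + k → j ∉ u) → (u ++ v) ≤P map (rotate c k) (u ++ v)
≤P-rotate         zero    u v _ _ _ _ _ = subst ((u ++ v) ≤P_) (sym (List.map-id (u ++ v))) ε
≤P-rotate {c} {n} (suc k) u v w-spans 1≤c c+k≤n c∉v between∉u =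
  ≤P-transpose w-spans 1≤c 1+c≤n (Precedes-split u v (between∉u (n<1+n c) 1+c≤c+k) c∉v)
  ◅◅ subst (map (transpose c) (u ++ v) ≤P_) (sym (List.map-∘ (u ++ v)))
       (subst (λ w → w ≤P map (rotate (suc c) k) w) (sym (List.map-++ (transpose c) u v))
         (≤P-rotate k (map (transpose c) u) (map (transpose c) v)
           (subst (Spans 0 n) (List.map-++ (transpose c) u v) (Spans-transpose 1≤c 1+c≤n w-spans))
           (s≤s z≤n) (≤-trans (≤-reflexive (sym (+-suc c k))) c+k≤n) 1+c∉v′ between∉u′))
  where
  1+c≤c+k : suc c ≤ c + suc k
  1+c≤c+k = ≤-trans (s≤s (m≤m+n c k)) (≤-reflexive (sym (+-suc c k)))
  1+c≤n : suc c ≤ n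
  1+c≤n = ≤-trans 1+c≤c+k c+k≤n
  1+c∉v′ : suc c ∉ map (transpose c) v
  1+c∉v′ 1+c∈ with ∈-map⁻ (transpose c) 1+c∈
  ... | x , x∈v , 1+c≡tx =
    c∉v (subst (_∈ v) (transpose-injective c (trans (sym 1+c≡tx) (sym (transpose-c c)))) x∈v)
  between∉u′ : ∀ {j} → suc c < j → j ≤ suc c + k → j ∉ map (transpose c) u
  between∉u′ {j} 1+c<j j≤ j∈ with ∈-map⁻ (transpose c) j∈
  ... | x , x∈u , j≡tx =
    between∉u (<-trans (n<1+n c) 1+c<j) (≤-trans j≤ (≤-reflexive (sym (+-suc c k))))
      (subst (_∈ u) (transpose-injective c (trans (sym j≡tx) (sym (transpose-other (>⇒≢ (<-trans (n<1+n c) 1+c<j))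
                                                                                     (>⇒≢ 1+c<j))))) x∈u)

-- The root a of the first subtree is rotated through the values a + 1, …,
-- a + W of the other subtrees, after which it is adjacent to the root R and
-- one up step merges the two.
module Rule2 {t ts′ w ws′} (len-ts : 2 ≤ length (t ∷ ts′)) (ts-ok : All Valid (t ∷ ts′))
             (ws-ok : All Valid (w ∷ ws′)) where

  private
    ts ws : List Tree
    ts = t ∷ ts′
    ws = w ∷ ws′
    T₀ a W R : ℕ
    T₀ = nodeCountL ts
    a  = suc T₀
    W  = nodeCountL ws
    R  = suc (a + W)
    P Q : List (List ℕ)
    P = childWords 0 ts
    Q = childWords T₀ ws
    u v : List ℕ
    u = shift 0 (intercalate [ a ] P)
    v = R ∷ intercalate [ R ] (childWords a ws)
    P≤a+W : All (All (_≤ a + W)) P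
    P≤a+W = All.map (All.map (λ (_ , x≤T₀) → ≤-trans x≤T₀ (≤-trans (n≤1+n T₀) (m≤m+n a W))))
                    (childWords-bounds 0 ts-ok)
    Q≤T₀+W : All (All (_≤ T₀ + W)) Q
    Q≤T₀+W = All.map (All.map proj₂) (childWords-bounds T₀ ws-ok)

  rotated : List ℕ
  rotated = intercalate [ a + W ] P ++ R ∷ intercalate [ R ] Q

  rotate-toWord : map (rotate a W) (u ++ v) ≡ rotated
  rotate-toWord = trans (List.map-++ (rotate a W) u v)
                        (cong₂ _++_ rotate-u (cong₂ _∷_ (rotate-above W ≤-refl) rotate-v))
    where
    open ≡-Reasoning
    rotate-u : map (rotate a W) u ≡ intercalate [ a + W ] P
    rotate-u = begin
      map (rotate a W) u                                      ≡⟨ List.map-∘ (intercalate [ a ] P) ⟨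
      map (rotate a W) (intercalate [ a ] P)                  ≡⟨ map-intercalate (rotate a W) [ a ] P ⟩
      intercalate [ rotate a W a ] (map (map (rotate a W)) P)
        ≡⟨ cong₂ (λ s ps → intercalate [ s ] ps) (rotate-start a W)
                 (List.map-id-local (All.map
                   (λ p-bounds → List.map-id-local (All.map (λ (_ , x≤) → rotate-below W (s≤s x≤)) p-bounds))
                   (childWords-bounds 0 ts-ok))) ⟩
      intercalate [ a + W ] P                                 ∎
    rotate-v : map (rotate a W) (intercalate [ R ] (childWords a ws)) ≡ intercalate [ R ] Q
    rotate-v = begin
      map (rotate a W) (intercalate [ R ] (childWords a ws))
        ≡⟨ map-intercalate (rotate a W) [ R ] (childWords a ws) ⟩
      intercalate [ rotate a W R ] (map (map (rotate a W)) (childWords a ws))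
        ≡⟨ cong₂ (λ s ps → intercalate [ s ] ps) (rotate-above W ≤-refl)
                 (List.map-cong-local (All.map
                   (λ p-bounds → List.map-cong-local (All.map (λ (a<x , x≤) → rotate-inside W a<x x≤) p-bounds))
                   (childWords-bounds a ws-ok))) ⟩
      intercalate [ R ] (map (map pred) (childWords a ws))
        ≡⟨ cong (intercalate [ R ]) (childWords-pred T₀ ws) ⟩
      intercalate [ R ] Q ∎

  private
    toWord-spans′ : Spans 0 R (u ++ v)
    toWord-spans′ = toWord-spans (node (s≤s (s≤s z≤n)) (node len-ts ts-ok ∷ ws-ok))
    rotated-spans : Spans 0 R rotated
    rotated-spans = subst (Spans 0 R) rotate-toWord (Spans-rotate W (s≤s z≤n) (n≤1+n _) toWord-spans′)

  rotation : toWord (node (node ts ∷ ws)) ≤P rotated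
  rotation = subst ((u ++ v) ≤P_) rotate-toWord
                   (≤P-rotate W u v toWord-spans′ (s≤s z≤n) (n≤1+n _) a∉v between∉u)
    where
    a∉v : a ∉ v
    a∉v = All-≢⇒∉ (R≢a ∷ intercalate-All (childWords a ws) (R≢a ∷ [])
                    (All.concat⁺ (All.map (All.map (λ (a<x , _) → >⇒≢ a<x)) (childWords-bounds a ws-ok))))
      where
      R≢a : R ≢ a
      R≢a = >⇒≢ (s≤s (m≤m+n a W))
    between∉u : ∀ {j} → a < j → j ≤ a + W → j ∉ u
    between∉u a<j _ j∈u =
      <⇒≱ a<j (All.lookup (All.map⁺ (All.map proj₂ (proj₁ (toWord-spans (node len-ts ts-ok))))) j∈u)

  merge-rotated : merge (a + W) rotated ≡ toWord (node (ts ++ ws))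
  merge-rotated = begin
    merge (a + W) (intercalate [ a + W ] P ++ R ∷ intercalate [ R ] Q)
      ≡⟨ List.map-++ (mergeVal (a + W)) (intercalate [ a + W ] P) (R ∷ intercalate [ R ] Q) ⟩
    merge (a + W) (intercalate [ a + W ] P) ++ mergeVal (a + W) R ∷ merge (a + W) (intercalate [ R ] Q)
      ≡⟨ cong₂ (λ xs ys → xs ++ mergeVal (a + W) R ∷ ys)
               (merge-identity (intercalate-All P (≤-refl ∷ []) (All.concat⁺ P≤a+W)))
               (map-intercalate (mergeVal (a + W)) [ R ] Q) ⟩
    intercalate [ a + W ] P ++ mergeVal (a + W) R ∷ intercalate [ mergeVal (a + W) R ] (map (merge (a + W)) Q)
      ≡⟨ cong₂ (λ s qs → intercalate [ a + W ] P ++ s ∷ intercalate [ s ] qs) (mergeVal-1+i (a + W))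
               (List.map-id-local (All.map (λ q≤ → merge-identity (All.map m≤n⇒m≤1+n q≤)) Q≤T₀+W)) ⟩
    intercalate [ a + W ] P ++ (a + W) ∷ intercalate [ a + W ] Q
      ≡⟨ intercalate-++ [ a + W ] (shift 0 (toWord t)) (childWords (0 + nodeCount t) ts′)
                                  (shift T₀ (toWord w)) (childWords (T₀ + nodeCount w) ws′) ⟨
    intercalate [ a + W ] (P ++ Q)
      ≡⟨ toWord-++ ts ws ⟨
    toWord (node (ts ++ ws)) ∎
    where open ≡-Reasoning

  up-step : BStep rotated (toWord (node (ts ++ ws)))
  up-step = subst (BStep rotated) merge-rotated
    (up (a + W) (Spans⇒Packed rotated-spans) (s≤s z≤n) (≤-reflexive (sym (Spans-maxW rotated-spans)))
      (Precedes⇒Before rotated (Precedes-split (intercalate [ a + W ] P) (R ∷ intercalate [ R ] Q)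
        (All-≢⇒∉ (intercalate-All P (<⇒≢ ≤-refl ∷ [])
          (All.concat⁺ (All.map (All.map (λ x≤ → <⇒≢ (s≤s x≤))) P≤a+W))))
        (All-≢⇒∉ (>⇒≢ ≤-refl ∷ intercalate-All Q (>⇒≢ ≤-refl ∷ [])
          (All.concat⁺ (All.map (All.map (λ x≤ → <⇒≢ (s≤s x≤))) Q≤T₀+W)))))))

toWord-rule2 : ∀ {ts ws} → 2 ≤ length ts → 1 ≤ length ws → All Valid ts → All Valid ws →
               toWord (node (node ts ∷ ws)) ≤P toWord (node (ts ++ ws))
toWord-rule2 {[]}    ()
toWord-rule2 {_ ∷ _} {[]}    _      ()
toWord-rule2 {_ ∷ _} {_ ∷ _} len-ts _ ts-ok ws-ok = rotation ◅◅ up-step ◅ ε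
  where open Rule2 len-ts ts-ok ws-ok

toWord-mono : ∀ {t z} → t ≤T z → toWord t ≤P toWord z
toWord-mono ≤T-refl                               = ε
toWord-mono (≤T-trans t≤u u≤z)                    = toWord-mono t≤u ◅◅ toWord-mono u≤z
toWord-mono (rule1 len ls-ok rs-ok t-ok w-ok t≤w) = toWord-rule1 len ls-ok rs-ok t-ok w-ok (toWord-mono t≤w)
toWord-mono (rule2 len-ts len-ws ts-ok ws-ok)     = toWord-rule2 len-ts len-ws ts-ok ws-ok
toWord-mono (rule3 len-ts len-us ts-ok us-ok)     = toWord-rule3 len-ts len-us ts-ok us-ok


mainTheorem16 : (n : ℕ) (t z : Tree) → InT n t → InT n z →
    (t ≤T z ⇔ Σ (List ℕ) λ γ → Σ (List ℕ) λ δ →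
       InP n γ × InP n δ × Γ γ ≡ t × Γ δ ≡ z × γ ≤P δ)
mainTheorem16 n t z t∈T z∈T = mk⇔
  (λ t≤z → toWord t , toWord z , toWord-∈P t∈T , toWord-∈P z∈T ,
           Γ-toWord (proj₁ t∈T) , Γ-toWord (proj₁ z∈T) , toWord-mono t≤z)
  (λ (γ , δ , _ , _ , Γγ≡t , Γδ≡z , γ≤δ) → subst₂ _≤T_ Γγ≡t Γδ≡z (Γ-mono γ≤δ))
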